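{- Let $G$ be a connected finite simple graph, $k$ a positive odd integer, and suppose there are $0<\alpha_1<\alpha_2<\cdots<\alpha_k<1$ such that the values $\beta_i=\operatorname{N}(G;\alpha_i)$ satisfy $0<\beta_1$ and the alternating pattern $\beta_1>\beta_2<\beta_3>\beta_4<\cdots<\beta_k$, i.e. for $1\le i\le k-1$, $\beta_i>\beta_{i+1}$ if $i$ is odd and $\beta_i<\beta_{i+1}$ if $i$ is even. Then there exist a positive integer $l$ and numbers $0<\alpha_1'<\alpha_2'<\cdots<\alpha_k'<\alpha_{k+1}'<1$ such that, writing $H=G[K_l]\cup K_1$ and $\beta_i'=\operatorname{N}(H;\alpha_i')$ for $1\le i\le k+1$, we have $0<\beta_1'>\beta_2'<\beta_3'>\beta_4'<\cdots<\beta_k'>\beta_{k+1}'$, i.e. $\beta_1'>0$ and for $1\le i\le k$, $\beta_i'>\beta_{i+1}'$ if $i$ is odd and $\beta_i'<\beta_{i+1}'$ if $i$ is even.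
   Context: For a finite simple graph $G$, the node reliability $\operatorname{N}(G;p)$ is the probability that, when each vertex of $G$ is independently operational with probability $p\in[0,1]$ (edges being perfectly reliable), the set of operational vertices is nonempty and induces a connected subgraph of $G$. For a positive integer $l$, $G[K_l]$ denotes the lexicographic product of $G$ with $K_l$: the graph obtained from $G$ by replacing each vertex $v$ by a complete graph $K_l^v$ on $l$ vertices, where two vertices in $K_l^u$ and $K_l^v$ with $u\neq v$ are adjacent iff $uv$ is an edge of $G$, and all vertices within the same $K_l^v$ are adjacent. For a graph $F$, $F\cup K_1$ denotes the graph obtained from $F$ by adding one new isolated vertex.
   Formalization: The points $\alpha_i$ in the hypothesis are rational, and the points $\alpha_i'$ in the conclusion are likewise taken in ℚ. -}

module Defs where

open import Data.Nat as ℕ using (ℕ; zero; suc)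
open import Data.Bool using (Bool; true; false; _∧_; _∨_; not; if_then_else_)
open import Data.Fin as Fin using (Fin; remQuot)
open import Data.Product using (_×_; _,_)
open import Data.List using (List; []; _∷_; map; _++_; foldr)
open import Data.Rational using (ℚ; 0ℚ; 1ℚ; _+_; _*_; _-_)
open import Relation.Nullary using (does)
open import Relation.Binary.PropositionalEquality using (_≡_)

record Graph : Set where
  constructor mkGraph
  field
    size : ℕ
    adj  : Fin size → Fin size → Bool
open Graph public

IsSimple : Graph → Set
IsSimple G = (∀ u v → adj G u v ≡ adj G v u) × (∀ u → adj G u u ≡ false)

anyF : ∀ {n} → (Fin n → Bool) → Bool
anyF {zero}  f = false
anyF {suc n} f = f Fin.zero ∨ anyF (λ i → f (Fin.suc i))

allF : ∀ {n} → (Fin n → Bool) → Bool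
allF {zero}  f = true
allF {suc n} f = f Fin.zero ∧ allF (λ i → f (Fin.suc i))

_==_ : ∀ {n} → Fin n → Fin n → Bool
u == v = does (u Fin.≟ v)

Subset : ℕ → Set
Subset n = Fin n → Bool

reach : (G : Graph) → Subset (size G) → ℕ → Fin (size G) → Fin (size G) → Bool
reach G S zero    u v = (u == v) ∧ S u
reach G S (suc k) u v =
  reach G S k u v ∨ anyF (λ w → S w ∧ (reach G S k u w ∧ adj G w v))

-- S is nonempty and the induced subgraph G[S] is connected
-- (walks of length ≤ |V(G)| suffice).
inducesConnected : (G : Graph) → Subset (size G) → Bool
inducesConnected G S =
  anyF S ∧
  allF (λ u → allF (λ v → not (S u ∧ S v) ∨ reach G S (size G) u v))

-- G is connected (in particular nonempty).
Connected : Graph → Set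
Connected G = inducesConnected G (λ _ → true) ≡ true

subsets : (n : ℕ) → List (Subset n)
subsets zero = (λ ()) ∷ []
subsets (suc n) =
  map (λ S → λ { Fin.zero → false ; (Fin.suc i) → S i }) (subsets n) ++
  map (λ S → λ { Fin.zero → true  ; (Fin.suc i) → S i }) (subsets n)

card : ∀ {n} → Subset n → ℕ
card {zero}  S = 0
card {suc n} S = (if S Fin.zero then 1 else 0) ℕ.+ card (λ i → S (Fin.suc i))

pow : ℚ → ℕ → ℚ
pow p zero    = 1ℚ
pow p (suc k) = p * pow p k

sumℚ : List ℚ → ℚ
sumℚ = foldr _+_ 0ℚ

N : Graph → ℚ → ℚ
N G p = sumℚ (map term (subsets (size G)))
  where
  term : Subset (size G) → ℚ
  term S = if inducesConnected G S
           then pow p (card S) * pow (1ℚ - p) (size G ℕ.∸ card S)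
           else 0ℚ

-- Lexicographic product G[K_l]: vertex x ∈ Fin (n*l) corresponds to (u,i) = remQuot l x.
lexK : Graph → ℕ → Graph
lexK G l = mkGraph (size G ℕ.* l) a
  where
  a : Fin (size G ℕ.* l) → Fin (size G ℕ.* l) → Bool
  a x y with remQuot l x | remQuot l y
  ... | (u , i) | (v , j) = ((u == v) ∧ not (i == j)) ∨ adj G u v

-- F ∪ K_1: add a new isolated vertex (Fin.zero).
addIsolated : Graph → Graph
addIsolated F = mkGraph (suc (size F)) a
  where
  a : Fin (suc (size F)) → Fin (suc (size F)) → Bool
  a Fin.zero    _           = false
  a (Fin.suc _) Fin.zero    = false
  a (Fin.suc x) (Fin.suc y) = adj F x y

Odd : ℕ → Set
Odd i = i ℕ.% 2 ≡ 1

Even : ℕ → Set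
Even i = i ℕ.% 2 ≡ 0

-- The reliability of H = G[K_l] ∪ K₁ factors as
--   N(H; x) = (1 - x) · N(G; 1 - (1 - x)ˡ) + x (1 - x)^(nl):
-- a vertex set of G[K_l] induces a connected graph iff the set of blocks it
-- meets does so in G, each block being met with probability 1 - (1 - x)ˡ, and
-- a set containing the isolated vertex is connected only if it is that vertex.
-- For x ≤ ρ small the factor 1 - x and the last term change N(H; x) by at most
-- ρ, while for l large the bias 1 - (1 - x)ˡ sweeps [0, αₖ] as x runs over
-- [0, ρ]. Choosing α′ᵢ ≤ ρ with 1 - (1 - α′ᵢ)ˡ just above αᵢ therefore gives
-- N(H; α′ᵢ) within 2ρ of N(G; αᵢ), which keeps the k alternations; the new
-- point α′ₖ₊₁ = 1 - ρ, where N(H; ·) ≤ 2ρ, adds one more descent after βₖ.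

module Submission where

open import Defs

open import Data.Bool using (Bool; true; false; _∧_; _∨_; not; if_then_else_)
import Data.Bool.Properties as Boolₚ
open import Data.Empty using (⊥; ⊥-elim)
open import Data.Fin as Fin using (Fin; combine; remQuot; splitAt)
import Data.Fin.Properties as Finₚ
import Data.Integer as ℤ
import Data.Integer.Properties as ℤₚ
open import Data.List using ([]; _∷_; map; _++_)
import Data.List.Properties as Listₚ
open import Data.Maybe.Base using (Maybe; just; nothing)
open import Data.Nat as ℕ using (ℕ; zero; suc; _≤_; _<_; z≤n; s≤s)
import Data.Nat.Properties as ℕₚ
open import Data.Product using (Σ; ∃; _×_; _,_; proj₁; proj₂)
open import Data.Rational as ℚ
  using (ℚ; 0ℚ; 1ℚ; mkℚ; _+_; _*_; _-_; -_; _⊓_; 1/_; toℚᵘ)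
  renaming (_≤_ to _≤ℚ_; _<_ to _<ℚ_)
import Data.Rational.Properties as ℚₚ
import Data.Rational.Unnormalised as ℚᵘ
import Data.Rational.Unnormalised.Properties as ℚᵘₚ
open import Data.Sum using (_⊎_; inj₁; inj₂; [_,_]′)
open import Data.Unit using (tt)
open import Function using (_∘_; case_of_)
open import Function.Bundles using (mk⇔)
open import Level using (0ℓ)
open import Relation.Binary.PropositionalEquality
open import Relation.Nullary using (yes; no; does)
open import Relation.Nullary.Decidable using (dec-true; dec-false; does-⇔; toWitness)
open import Tactic.RingSolver using (solve-∀)
open import Tactic.RingSolver.Core.AlmostCommutativeRing using (AlmostCommutativeRing; fromCommutativeRing)

-- Rational arithmetic

ℚ-ring : AlmostCommutativeRing 0ℓ 0ℓ
ℚ-ring = fromCommutativeRing ℚₚ.+-*-commutativeRing isZero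
  where
  isZero : ∀ x → Maybe (0ℚ ≡ x)
  isZero x with x ℚₚ.≟ 0ℚ
  ... | yes x≡0 = just (sym x≡0)
  ... | no _    = nothing

x≤y⇒0≤y-x : ∀ {x y} → x ≤ℚ y → 0ℚ ≤ℚ y - x
x≤y⇒0≤y-x {x} {y} x≤y = subst (_≤ℚ y - x) (ℚₚ.+-inverseʳ x) (ℚₚ.+-monoˡ-≤ (- x) x≤y)

x<y⇒0<y-x : ∀ {x y} → x <ℚ y → 0ℚ <ℚ y - x
x<y⇒0<y-x {x} {y} x<y = subst (_<ℚ y - x) (ℚₚ.+-inverseʳ x) (ℚₚ.+-monoˡ-< (- x) x<y)

-- Inequalities are proved by exhibiting the difference as a manifestly
-- nonnegative (positive) expression; the identity is left to the ring solver.
≤-by-difference : ∀ {x y} d → y - x ≡ d → 0ℚ ≤ℚ d → x ≤ℚ y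
≤-by-difference {x} {y} d y-x≡d 0≤d =
  subst₂ _≤ℚ_ (ℚₚ.+-identityˡ x) (cancel x y)
    (ℚₚ.+-monoˡ-≤ x (subst (0ℚ ≤ℚ_) (sym y-x≡d) 0≤d))
  where
  cancel : ∀ x y → (y - x) + x ≡ y
  cancel = solve-∀ ℚ-ring

<-by-difference : ∀ {x y} d → y - x ≡ d → 0ℚ <ℚ d → x <ℚ y
<-by-difference {x} {y} d y-x≡d 0<d =
  subst₂ _<ℚ_ (ℚₚ.+-identityˡ x) (cancel x y)
    (ℚₚ.+-monoˡ-< x (subst (0ℚ <ℚ_) (sym y-x≡d) 0<d))
  where
  cancel : ∀ x y → (y - x) + x ≡ y
  cancel = solve-∀ ℚ-ring

nonNeg+nonNeg : ∀ {a b} → 0ℚ ≤ℚ a → 0ℚ ≤ℚ b → 0ℚ ≤ℚ a + b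
nonNeg+nonNeg {a} {b} 0≤a 0≤b = subst (_≤ℚ a + b) (ℚₚ.+-identityˡ 0ℚ) (ℚₚ.+-mono-≤ 0≤a 0≤b)

pos+nonNeg : ∀ {a b} → 0ℚ <ℚ a → 0ℚ ≤ℚ b → 0ℚ <ℚ a + b
pos+nonNeg {a} {b} 0<a 0≤b = subst (_<ℚ a + b) (ℚₚ.+-identityˡ 0ℚ) (ℚₚ.+-mono-<-≤ 0<a 0≤b)

nonNeg+pos : ∀ {a b} → 0ℚ ≤ℚ a → 0ℚ <ℚ b → 0ℚ <ℚ a + b
nonNeg+pos {a} {b} 0≤a 0<b = subst (_<ℚ a + b) (ℚₚ.+-identityˡ 0ℚ) (ℚₚ.+-mono-≤-< 0≤a 0<b)

nonNeg*nonNeg : ∀ {a b} → 0ℚ ≤ℚ a → 0ℚ ≤ℚ b → 0ℚ ≤ℚ a * b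
nonNeg*nonNeg {a} {b} 0≤a 0≤b = ℚₚ.nonNegative⁻¹ (a * b)
  {{ℚₚ.nonNeg*nonNeg⇒nonNeg a {{ℚ.nonNegative 0≤a}} b {{ℚ.nonNegative 0≤b}}}}

pos*pos : ∀ {a b} → 0ℚ <ℚ a → 0ℚ <ℚ b → 0ℚ <ℚ a * b
pos*pos {a} {b} 0<a 0<b = ℚₚ.positive⁻¹ (a * b)
  {{ℚₚ.pos*pos⇒pos a {{ℚ.positive 0<a}} b {{ℚ.positive 0<b}}}}

pos⊓pos : ∀ {a b} → 0ℚ <ℚ a → 0ℚ <ℚ b → 0ℚ <ℚ a ⊓ b
pos⊓pos {a} {b} 0<a 0<b with ℚₚ.⊓-sel a b
... | inj₁ a⊓b≡a = subst (0ℚ <ℚ_) (sym a⊓b≡a) 0<a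
... | inj₂ a⊓b≡b = subst (0ℚ <ℚ_) (sym a⊓b≡b) 0<b

0<1 : 0ℚ <ℚ 1ℚ
0<1 = ℚₚ.positive⁻¹ 1ℚ

0≤1 : 0ℚ ≤ℚ 1ℚ
0≤1 = ℚₚ.<⇒≤ 0<1

fromℕ : ℕ → ℚ
fromℕ zero    = 0ℚ
fromℕ (suc n) = fromℕ n + 1ℚ

fromℕ-nonNeg : ∀ n → 0ℚ ≤ℚ fromℕ n
fromℕ-nonNeg zero    = ℚₚ.≤-refl
fromℕ-nonNeg (suc n) = nonNeg+nonNeg (fromℕ-nonNeg n) 0≤1

fromℕ-pos : ∀ n → 0ℚ <ℚ fromℕ (suc n)
fromℕ-pos n = subst (_<ℚ fromℕ n + 1ℚ) (ℚₚ.+-identityʳ 0ℚ) (ℚₚ.+-mono-≤-< (fromℕ-nonNeg n) 0<1)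

fromℕ-mono : ∀ {m n} → m ≤ n → fromℕ m ≤ℚ fromℕ n
fromℕ-mono {zero} {n} z≤n = fromℕ-nonNeg n
fromℕ-mono (s≤s m≤n)      = ℚₚ.+-monoˡ-≤ 1ℚ (fromℕ-mono m≤n)

fromℕ-toℚᵘ : ∀ n → toℚᵘ (fromℕ n) ℚᵘ.≃ ℚᵘ.mkℚᵘ (ℤ.+ n) 0
fromℕ-toℚᵘ zero    = ℚᵘ.*≡* refl
fromℕ-toℚᵘ (suc n) = ℚᵘₚ.≃-trans (ℚₚ.toℚᵘ-homo-+ (fromℕ n) 1ℚ)
  (ℚᵘₚ.≃-trans (ℚᵘₚ.+-congˡ (toℚᵘ 1ℚ) (fromℕ-toℚᵘ n)) (ℚᵘ.*≡* cross))
  where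
  cross : ((ℤ.+ n ℤ.* ℤ.+ 1 ℤ.+ ℤ.+ 1 ℤ.* ℤ.+ 1) ℤ.* ℤ.+ 1) ≡ ℤ.+ suc n ℤ.* ℤ.+ 1
  cross = trans (ℤₚ.*-identityʳ _) (trans (cong₂ ℤ._+_ (ℤₚ.*-identityʳ (ℤ.+ n)) refl)
            (trans (cong ℤ.+_ (ℕₚ.+-comm n 1)) (sym (ℤₚ.*-identityʳ _))))

-- For r = (a+1)/(d+1), the multiple (d+1)·r is the integer a+1.
archimedean-1 : ∀ {r} → 0ℚ <ℚ r → ∃ λ m → 1ℚ ≤ℚ fromℕ m * r
archimedean-1 {mkℚ ℤ.+[1+ a ] d coprime} _ = suc d , ℚₚ.toℚᵘ-cancel-≤
  (ℚᵘₚ.≤-respʳ-≃ (ℚᵘₚ.≃-sym (ℚᵘₚ.≃-trans (ℚₚ.toℚᵘ-homo-* (fromℕ (suc d)) (mkℚ ℤ.+[1+ a ] d coprime))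
     (ℚᵘₚ.*-congʳ (fromℕ-toℚᵘ (suc d))))) (ℚᵘ.*≤* (ℤ.+≤+ d+1≤[d+1][a+1])))
  where
  d+1≤[d+1][a+1] : 1 ℕ.* (1 ℕ.* suc d) ≤ (suc d ℕ.* suc a) ℕ.* 1
  d+1≤[d+1][a+1] rewrite ℕₚ.*-identityˡ (1 ℕ.* suc d) | ℕₚ.*-identityˡ (suc d)
                       | ℕₚ.*-identityʳ (suc d ℕ.* suc a) = ℕₚ.m≤m*n (suc d) (suc a)
archimedean-1 {mkℚ ℤ.+0 d coprime} 0<r with ℚ.positive {mkℚ ℤ.+0 d coprime} 0<r
... | record { pos = () }
archimedean-1 {mkℚ ℤ.-[1+ a ] d coprime} (ℚ.*<* ())

archimedean : ∀ {q r} → 0ℚ <ℚ q → 0ℚ <ℚ r → ∃ λ m → q ≤ℚ fromℕ m * r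
archimedean {q} {r} 0<q 0<r = m , q≤m*r
  where
  instance
    q≢0 : ℚ.NonZero q
    q≢0 = ℚₚ.pos⇒nonZero q {{ℚ.positive 0<q}}
  0<1/q : 0ℚ <ℚ 1/ q
  0<1/q = ℚₚ.positive⁻¹ (1/ q) {{ℚₚ.1/pos⇒pos q {{ℚ.positive 0<q}}}}
  m : ℕ
  m = proj₁ (archimedean-1 (pos*pos 0<r 0<1/q))
  regroup : ∀ q m r q⁻¹ → q * (m * (r * q⁻¹)) ≡ (m * r) * (q * q⁻¹)
  regroup = solve-∀ ℚ-ring
  open ℚₚ.≤-Reasoning
  q≤m*r : q ≤ℚ fromℕ m * r
  q≤m*r = begin
    q                                ≡⟨ sym (ℚₚ.*-identityʳ q) ⟩
    q * 1ℚ                           ≤⟨ ℚₚ.*-monoˡ-≤-nonNeg q {{ℚ.nonNegative (ℚₚ.<⇒≤ 0<q)}}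
                                          (proj₂ (archimedean-1 (pos*pos 0<r 0<1/q))) ⟩
    q * (fromℕ m * (r * 1/ q))       ≡⟨ regroup q (fromℕ m) r (1/ q) ⟩
    (fromℕ m * r) * (q * 1/ q)       ≡⟨ cong (fromℕ m * r *_) (ℚₚ.*-inverseʳ q) ⟩
    (fromℕ m * r) * 1ℚ               ≡⟨ ℚₚ.*-identityʳ _ ⟩
    fromℕ m * r                      ∎

Prob : ℚ → Set
Prob x = 0ℚ ≤ℚ x × x ≤ℚ 1ℚ

prob-complement : ∀ {a} → Prob a → Prob (1ℚ - a)
prob-complement {a} (0≤a , a≤1) = x≤y⇒0≤y-x a≤1 , ≤-by-difference a (involutive a) 0≤a
  where
  involutive : ∀ a → 1ℚ - (1ℚ - a) ≡ a
  involutive = solve-∀ ℚ-ring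

prob-* : ∀ {a b} → Prob a → Prob b → Prob (a * b)
prob-* {a} {b} (0≤a , a≤1) (0≤b , b≤1) =
  nonNeg*nonNeg 0≤a 0≤b ,
  ≤-by-difference ((1ℚ - a) + a * (1ℚ - b)) (expand a b)
    (nonNeg+nonNeg (x≤y⇒0≤y-x a≤1) (nonNeg*nonNeg 0≤a (x≤y⇒0≤y-x b≤1)))
  where
  expand : ∀ a b → 1ℚ - a * b ≡ (1ℚ - a) + a * (1ℚ - b)
  expand = solve-∀ ℚ-ring

prob-pow : ∀ {a} k → Prob a → Prob (pow a k)
prob-pow zero    _     = 0≤1 , ℚₚ.≤-refl
prob-pow (suc k) a∈[0,1] = prob-* a∈[0,1] (prob-pow k a∈[0,1])

pow-nonNeg : ∀ {a} k → 0ℚ ≤ℚ a → 0ℚ ≤ℚ pow a k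
pow-nonNeg zero    _   = 0≤1
pow-nonNeg (suc k) 0≤a = nonNeg*nonNeg 0≤a (pow-nonNeg k 0≤a)

pow-mono : ∀ {a b} k → 0ℚ ≤ℚ b → b ≤ℚ a → pow b k ≤ℚ pow a k
pow-mono zero 0≤b b≤a = ℚₚ.≤-refl
pow-mono {a} {b} (suc k) 0≤b b≤a =
  ≤-by-difference (a * (pow a k - pow b k) + pow b k * (a - b)) (expand a b (pow a k) (pow b k))
    (nonNeg+nonNeg (nonNeg*nonNeg (ℚₚ.≤-trans 0≤b b≤a) (x≤y⇒0≤y-x (pow-mono k 0≤b b≤a)))
                   (nonNeg*nonNeg (pow-nonNeg k 0≤b) (x≤y⇒0≤y-x b≤a)))
  where
  expand : ∀ a b A B → a * A - b * B ≡ a * (A - B) + B * (a - b)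
  expand = solve-∀ ℚ-ring

pow-lipschitz : ∀ {a b} k → 0ℚ ≤ℚ b → b ≤ℚ a → a ≤ℚ 1ℚ → pow a k ≤ℚ pow b k + fromℕ k * (a - b)
pow-lipschitz {a} {b} zero _ _ _ = ≤-by-difference 0ℚ (cancel a b) ℚₚ.≤-refl
  where
  cancel : ∀ a b → (1ℚ + 0ℚ * (a - b)) - 1ℚ ≡ 0ℚ
  cancel = solve-∀ ℚ-ring
pow-lipschitz {a} {b} (suc k) 0≤b b≤a a≤1 =
  ≤-by-difference
    (a * ((pow b k + fromℕ k * (a - b)) - pow a k) + (1ℚ - a) * (fromℕ k * (a - b)) + (1ℚ - pow b k) * (a - b))
    (expand a b (pow a k) (pow b k) (fromℕ k))
    (nonNeg+nonNeg
      (nonNeg+nonNeg (nonNeg*nonNeg (ℚₚ.≤-trans 0≤b b≤a) (x≤y⇒0≤y-x (pow-lipschitz k 0≤b b≤a a≤1)))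
                     (nonNeg*nonNeg (x≤y⇒0≤y-x a≤1) (nonNeg*nonNeg (fromℕ-nonNeg k) (x≤y⇒0≤y-x b≤a))))
      (nonNeg*nonNeg (x≤y⇒0≤y-x (proj₂ (prob-pow k (0≤b , ℚₚ.≤-trans b≤a a≤1)))) (x≤y⇒0≤y-x b≤a)))
  where
  expand : ∀ a b A B K → (b * B + (K + 1ℚ) * (a - b)) - a * A ≡
           a * ((B + K * (a - b)) - A) + (1ℚ - a) * (K * (a - b)) + (1ℚ - B) * (a - b)
  expand = solve-∀ ℚ-ring

bernoulli : ∀ {e} k → Prob e → pow (1ℚ - e) k * (1ℚ + fromℕ k * e) ≤ℚ 1ℚ
bernoulli {e} zero _ = ≤-by-difference 0ℚ (cancel e) ℚₚ.≤-refl
  where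
  cancel : ∀ e → 1ℚ - 1ℚ * (1ℚ + 0ℚ * e) ≡ 0ℚ
  cancel = solve-∀ ℚ-ring
bernoulli {e} (suc k) e∈[0,1]@(0≤e , _) =
  ≤-by-difference
    ((1ℚ - pow (1ℚ - e) k * (1ℚ + fromℕ k * e)) + pow (1ℚ - e) k * ((fromℕ k + 1ℚ) * (e * e)))
    (expand e (pow (1ℚ - e) k) (fromℕ k))
    (nonNeg+nonNeg (x≤y⇒0≤y-x (bernoulli k e∈[0,1]))
      (nonNeg*nonNeg (proj₁ (prob-pow k (prob-complement e∈[0,1])))
                     (nonNeg*nonNeg (fromℕ-nonNeg (suc k)) (nonNeg*nonNeg 0≤e 0≤e))))
  where
  expand : ∀ e P K → 1ℚ - ((1ℚ - e) * P) * (1ℚ + (K + 1ℚ) * e) ≡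
           (1ℚ - P * (1ℚ + K * e)) + P * ((K + 1ℚ) * (e * e))
  expand = solve-∀ ℚ-ring

convex-prob : ∀ {y A B} → Prob y → Prob A → Prob B → Prob ((1ℚ - y) * A + y * B)
convex-prob {y} {A} {B} (0≤y , y≤1) (0≤A , A≤1) (0≤B , B≤1) =
  nonNeg+nonNeg (nonNeg*nonNeg (x≤y⇒0≤y-x y≤1) 0≤A) (nonNeg*nonNeg 0≤y 0≤B) ,
  ≤-by-difference ((1ℚ - y) * (1ℚ - A) + y * (1ℚ - B)) (expand y A B)
    (nonNeg+nonNeg (nonNeg*nonNeg (x≤y⇒0≤y-x y≤1) (x≤y⇒0≤y-x A≤1)) (nonNeg*nonNeg 0≤y (x≤y⇒0≤y-x B≤1)))
  where
  expand : ∀ y A B → 1ℚ - ((1ℚ - y) * A + y * B) ≡ (1ℚ - y) * (1ℚ - A) + y * (1ℚ - B)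
  expand = solve-∀ ℚ-ring

Close : ℚ → ℚ → ℚ → Set
Close ε a b = a ≤ℚ b + ε × b ≤ℚ a + ε

close-trans : ∀ {ε δ a b c} → Close ε a b → Close δ b c → Close (ε + δ) a c
close-trans {ε} {δ} {a} {b} {c} (a≤b+ε , b≤a+ε) (b≤c+δ , c≤b+δ) =
  ≤-by-difference (((b + ε) - a) + ((c + δ) - b)) (regroup a b c ε δ)
    (nonNeg+nonNeg (x≤y⇒0≤y-x a≤b+ε) (x≤y⇒0≤y-x b≤c+δ)) ,
  ≤-by-difference (((a + ε) - b) + ((b + δ) - c)) (regroup′ a b c ε δ)
    (nonNeg+nonNeg (x≤y⇒0≤y-x b≤a+ε) (x≤y⇒0≤y-x c≤b+δ))
  where
  regroup : ∀ a b c ε δ → (c + (ε + δ)) - a ≡ ((b + ε) - a) + ((c + δ) - b)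
  regroup = solve-∀ ℚ-ring
  regroup′ : ∀ a b c ε δ → (a + (ε + δ)) - c ≡ ((a + ε) - b) + ((b + δ) - c)
  regroup′ = solve-∀ ℚ-ring

close-weaken : ∀ {ε δ a b} → ε ≤ℚ δ → Close ε a b → Close δ a b
close-weaken {ε} {δ} {a} {b} ε≤δ (a≤b+ε , b≤a+ε) =
  ℚₚ.≤-trans a≤b+ε (ℚₚ.+-monoʳ-≤ b ε≤δ) , ℚₚ.≤-trans b≤a+ε (ℚₚ.+-monoʳ-≤ a ε≤δ)

close-separated : ∀ {ε a a′ b b′} → Close ε a a′ → Close ε b b′ → b + (ε + ε) <ℚ a → b′ <ℚ a′
close-separated {ε} {a} {a′} {b} {b′} (a≤a′+ε , _) (_ , b′≤b+ε) gap =
  <-by-difference ((a - (b + (ε + ε))) + (((a′ + ε) - a) + ((b + ε) - b′))) (regroup a a′ b b′ ε)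
    (pos+nonNeg (x<y⇒0<y-x gap) (nonNeg+nonNeg (x≤y⇒0≤y-x a≤a′+ε) (x≤y⇒0≤y-x b′≤b+ε)))
  where
  regroup : ∀ a a′ b b′ ε → a′ - b′ ≡ (a - (b + (ε + ε))) + (((a′ + ε) - a) + ((b + ε) - b′))
  regroup = solve-∀ ℚ-ring

mix-close : ∀ {x P Z} → Prob x → Prob P → Prob Z → Close x P ((1ℚ - x) * P + x * Z)
mix-close {x} {P} {Z} (0≤x , _) (0≤P , P≤1) (0≤Z , Z≤1) =
  ≤-by-difference (x * (1ℚ - P) + x * Z) (expand₁ x P Z)
    (nonNeg+nonNeg (nonNeg*nonNeg 0≤x (x≤y⇒0≤y-x P≤1)) (nonNeg*nonNeg 0≤x 0≤Z)) ,
  ≤-by-difference (x * P + x * (1ℚ - Z)) (expand₂ x P Z)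
    (nonNeg+nonNeg (nonNeg*nonNeg 0≤x 0≤P) (nonNeg*nonNeg 0≤x (x≤y⇒0≤y-x Z≤1)))
  where
  expand₁ : ∀ x P Z → (((1ℚ - x) * P + x * Z) + x) - P ≡ x * (1ℚ - P) + x * Z
  expand₁ = solve-∀ ℚ-ring
  expand₂ : ∀ x P Z → (P + x) - ((1ℚ - x) * P + x * Z) ≡ x * P + x * (1ℚ - Z)
  expand₂ = solve-∀ ℚ-ring

close-refl : ∀ {ε a} → 0ℚ ≤ℚ ε → Close ε a a
close-refl {ε} {a} 0≤ε = a≤a+ε , a≤a+ε
  where
  a≤a+ε : a ≤ℚ a + ε
  a≤a+ε = subst (_≤ℚ a + ε) (ℚₚ.+-identityʳ a) (ℚₚ.+-monoʳ-≤ a 0≤ε)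

convex-close : ∀ {y δ A A′ B B′} → Prob y → Close δ A A′ → Close δ B B′ →
               Close δ ((1ℚ - y) * A + y * B) ((1ℚ - y) * A′ + y * B′)
convex-close {y} {δ} {A} {A′} {B} {B′} (0≤y , y≤1) (A≤A′+δ , A′≤A+δ) (B≤B′+δ , B′≤B+δ) =
  ≤-by-difference ((1ℚ - y) * ((A′ + δ) - A) + y * ((B′ + δ) - B)) (expand y δ A A′ B B′)
    (nonNeg+nonNeg (nonNeg*nonNeg (x≤y⇒0≤y-x y≤1) (x≤y⇒0≤y-x A≤A′+δ))
                   (nonNeg*nonNeg 0≤y (x≤y⇒0≤y-x B≤B′+δ))) ,
  ≤-by-difference ((1ℚ - y) * ((A + δ) - A′) + y * ((B + δ) - B′)) (expand y δ A′ A B′ B)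
    (nonNeg+nonNeg (nonNeg*nonNeg (x≤y⇒0≤y-x y≤1) (x≤y⇒0≤y-x A′≤A+δ))
                   (nonNeg*nonNeg 0≤y (x≤y⇒0≤y-x B′≤B+δ)))
  where
  expand : ∀ y δ A A′ B B′ → ((1ℚ - y) * A′ + y * B′ + δ) - ((1ℚ - y) * A + y * B) ≡
           (1ℚ - y) * ((A′ + δ) - A) + y * ((B′ + δ) - B)
  expand = solve-∀ ℚ-ring

convex-shift : ∀ {x y A B} → 0ℚ ≤ℚ x → x ≤ℚ y → y ≤ℚ 1ℚ → Prob A → Prob B →
               Close (y - x) ((1ℚ - x) * A + x * B) ((1ℚ - y) * A + y * B)
convex-shift {x} {y} {A} {B} _ x≤y _ (0≤A , A≤1) (0≤B , B≤1) =
  ≤-by-difference ((y - x) * (1ℚ - A) + (y - x) * B) (expand₁ x y A B)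
    (nonNeg+nonNeg (nonNeg*nonNeg (x≤y⇒0≤y-x x≤y) (x≤y⇒0≤y-x A≤1)) (nonNeg*nonNeg (x≤y⇒0≤y-x x≤y) 0≤B)) ,
  ≤-by-difference ((y - x) * (1ℚ - B) + (y - x) * A) (expand₂ x y A B)
    (nonNeg+nonNeg (nonNeg*nonNeg (x≤y⇒0≤y-x x≤y) (x≤y⇒0≤y-x B≤1)) (nonNeg*nonNeg (x≤y⇒0≤y-x x≤y) 0≤A))
  where
  expand₁ : ∀ x y A B → ((1ℚ - y) * A + y * B + (y - x)) - ((1ℚ - x) * A + x * B) ≡ (y - x) * (1ℚ - A) + (y - x) * B
  expand₁ = solve-∀ ℚ-ring
  expand₂ : ∀ x y A B → ((1ℚ - x) * A + x * B + (y - x)) - ((1ℚ - y) * A + y * B) ≡ (y - x) * (1ℚ - B) + (y - x) * A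
  expand₂ = solve-∀ ℚ-ring

positive-lower-bound : (f : ℕ → ℚ) (n : ℕ) → (∀ i → 1 ≤ i → i < n → 0ℚ <ℚ f i) →
                       ∃ λ δ → 0ℚ <ℚ δ × (∀ i → 1 ≤ i → i < n → δ ≤ℚ f i)
positive-lower-bound f zero          _   = 1ℚ , 0<1 , λ _ _ ()
positive-lower-bound f (suc zero)    _   = 1ℚ , 0<1 , λ { (suc i) _ (s≤s ()) }
positive-lower-bound f (suc (suc n)) pos =
  let δ , 0<δ , δ≤f = positive-lower-bound f (suc n) (λ i 1≤i i<n → pos i 1≤i (ℕₚ.m<n⇒m<1+n i<n))
  in δ ⊓ f (suc n) , pos⊓pos 0<δ (pos (suc n) (s≤s z≤n) ℕₚ.≤-refl) , below δ≤f
  where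
  below : ∀ {δ} → (∀ i → 1 ≤ i → i < suc n → δ ≤ℚ f i) →
          ∀ i → 1 ≤ i → i < suc (suc n) → δ ⊓ f (suc n) ≤ℚ f i
  below {δ} δ≤f i 1≤i i<n+2 with ℕₚ.m<1+n⇒m<n∨m≡n i<n+2
  ... | inj₁ i<n+1 = ℚₚ.≤-trans (ℚₚ.p⊓q≤p δ (f (suc n))) (δ≤f i 1≤i i<n+1)
  ... | inj₂ refl  = ℚₚ.p⊓q≤q δ (f (suc n))

crossingIndex : (ℕ → ℚ) → ℚ → ℕ → ℕ
crossingIndex f t zero    = zero
crossingIndex f t (suc J) with t ℚₚ.≤? f J
... | yes _ = crossingIndex f t J
... | no  _ = J

crossingIndex-spec : ∀ f t J → f 0 <ℚ t → t ≤ℚ f J →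
  let j = crossingIndex f t J in j < J × f j <ℚ t × t ≤ℚ f (suc j)
crossingIndex-spec f t zero f0<t t≤f0 = ⊥-elim (ℚₚ.<-irrefl refl (ℚₚ.<-≤-trans f0<t t≤f0))
crossingIndex-spec f t (suc J) f0<t t≤f[J+1] with t ℚₚ.≤? f J
... | yes t≤fJ = let j<J , below , above = crossingIndex-spec f t J f0<t t≤fJ
                 in ℕₚ.m<n⇒m<1+n j<J , below , above
... | no  t≰fJ = ℕₚ.≤-refl , ℚₚ.≰⇒> t≰fJ , t≤f[J+1]

-- A rational intermediate value theorem: scan the grid j·b/K, with the mesh b/K
-- chosen (Archimedes) so that one grid step moves f by at most η.
approximate-preimage :
  ∀ (f : ℚ → ℚ) {b L η} → 0ℚ <ℚ b → 0ℚ <ℚ L → 0ℚ <ℚ η →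
  (∀ {x y} → 0ℚ ≤ℚ x → x ≤ℚ y → y ≤ℚ b → f y ≤ℚ f x + L * (y - x)) →
  Σ (ℚ → ℚ) λ g → ∀ {t} → f 0ℚ <ℚ t → t ≤ℚ f b →
    0ℚ <ℚ g t × g t ≤ℚ b × t ≤ℚ f (g t) × f (g t) <ℚ t + η
approximate-preimage f {b} {L} {η} 0<b 0<L 0<η f-lipschitz = g , spec
  where
  M : ℕ
  M = proj₁ (archimedean (pos*pos 0<L 0<b) 0<η)
  K : ℕ
  K = suc M
  instance
    K≢0 : ℚ.NonZero (fromℕ K)
    K≢0 = ℚₚ.pos⇒nonZero (fromℕ K) {{ℚ.positive (fromℕ-pos M)}}
  u : ℚ
  u = b * 1/ fromℕ K
  grid : ℕ → ℚ
  grid j = fromℕ j * u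
  g : ℚ → ℚ
  g t = grid (suc (crossingIndex (f ∘ grid) t K))

  0<u : 0ℚ <ℚ u
  0<u = pos*pos 0<b (ℚₚ.positive⁻¹ _ {{ℚₚ.1/pos⇒pos (fromℕ K) {{ℚ.positive (fromℕ-pos M)}}}})

  grid-mono : ∀ {i j} → i ≤ j → grid i ≤ℚ grid j
  grid-mono i≤j = ℚₚ.*-monoʳ-≤-nonNeg u {{ℚ.nonNegative (ℚₚ.<⇒≤ 0<u)}} (fromℕ-mono i≤j)

  grid-step : ∀ j → grid (suc j) - grid j ≡ u
  grid-step j = cancel (fromℕ j) u
    where
    cancel : ∀ j u → (j + 1ℚ) * u - j * u ≡ u
    cancel = solve-∀ ℚ-ring

  grid-K : grid K ≡ b
  grid-K = trans (regroup (fromℕ K) b (1/ fromℕ K))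
                 (trans (cong (b *_) (ℚₚ.*-inverseʳ (fromℕ K))) (ℚₚ.*-identityʳ b))
    where
    regroup : ∀ k b k⁻¹ → k * (b * k⁻¹) ≡ b * (k * k⁻¹)
    regroup = solve-∀ ℚ-ring

  L*u≤η : L * u ≤ℚ η
  L*u≤η = ℚₚ.*-cancelˡ-≤-pos (fromℕ K) {{ℚ.positive (fromℕ-pos M)}} (begin
    fromℕ K * (L * u)  ≡⟨ trans (regroup (fromℕ K) L u) (cong (L *_) grid-K) ⟩
    L * b              ≤⟨ proj₂ (archimedean (pos*pos 0<L 0<b) 0<η) ⟩
    fromℕ M * η        ≤⟨ ℚₚ.*-monoʳ-≤-nonNeg η {{ℚ.nonNegative (ℚₚ.<⇒≤ 0<η)}}
                            (fromℕ-mono (ℕₚ.n≤1+n M)) ⟩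
    fromℕ K * η        ∎)
    where
    open ℚₚ.≤-Reasoning
    regroup : ∀ k L u → k * (L * u) ≡ L * (k * u)
    regroup = solve-∀ ℚ-ring

  spec : ∀ {t} → f 0ℚ <ℚ t → t ≤ℚ f b → 0ℚ <ℚ g t × g t ≤ℚ b × t ≤ℚ f (g t) × f (g t) <ℚ t + η
  spec {t} f0<t t≤fb = pos*pos (fromℕ-pos j) 0<u , gt≤b , above , (begin-strict
      f (grid (suc j))                           ≤⟨ f-lipschitz (nonNeg*nonNeg (fromℕ-nonNeg j) (ℚₚ.<⇒≤ 0<u))
                                                      (grid-mono (ℕₚ.n≤1+n j)) gt≤b ⟩
      f (grid j) + L * (grid (suc j) - grid j)   ≡⟨ cong (λ d → f (grid j) + L * d) (grid-step j) ⟩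
      f (grid j) + L * u                         <⟨ ℚₚ.+-mono-<-≤ below L*u≤η ⟩
      t + η                                      ∎)
    where
    open ℚₚ.≤-Reasoning
    j : ℕ
    j = crossingIndex (f ∘ grid) t K
    crossing : j < K × f (grid j) <ℚ t × t ≤ℚ f (grid (suc j))
    crossing = crossingIndex-spec (f ∘ grid) t K
                 (subst (λ x → f x <ℚ t) (sym (ℚₚ.*-zeroˡ u)) f0<t)
                 (subst (λ x → t ≤ℚ f x) (sym grid-K) t≤fb)
    below : f (grid j) <ℚ t
    below = proj₁ (proj₂ crossing)
    above : t ≤ℚ f (grid (suc j))
    above = proj₂ (proj₂ crossing)
    gt≤b : grid (suc j) ≤ℚ b
    gt≤b = ℚₚ.≤-trans (grid-mono (proj₁ crossing)) (ℚₚ.≤-reflexive grid-K)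

-- Connectivity of induced subgraphs

∨-introˡ : ∀ {a} b → a ≡ true → a ∨ b ≡ true
∨-introˡ b refl = refl

∨-introʳ : ∀ a {b} → b ≡ true → a ∨ b ≡ true
∨-introʳ true  _   = refl
∨-introʳ false b≡t = b≡t

∨-elim : ∀ a {b} → a ∨ b ≡ true → a ≡ true ⊎ b ≡ true
∨-elim true  _   = inj₁ refl
∨-elim false b≡t = inj₂ b≡t

∧-intro : ∀ {a b} → a ≡ true → b ≡ true → a ∧ b ≡ true
∧-intro refl b≡t = b≡t

∧-elimˡ : ∀ a {b} → a ∧ b ≡ true → a ≡ true
∧-elimˡ true _ = refl

∧-elimʳ : ∀ a {b} → a ∧ b ≡ true → b ≡ true
∧-elimʳ true b≡t = b≡t

≡-from-⇔true : ∀ {a b} → (a ≡ true → b ≡ true) → (b ≡ true → a ≡ true) → a ≡ b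
≡-from-⇔true {true}  {true}  _ _ = refl
≡-from-⇔true {true}  {false} a⇒b _ = sym (a⇒b refl)
≡-from-⇔true {false} {true}  _ b⇒a = b⇒a refl
≡-from-⇔true {false} {false} _ _ = refl

anyF-intro : ∀ {n} (f : Fin n → Bool) i → f i ≡ true → anyF f ≡ true
anyF-intro f Fin.zero    fi≡t = ∨-introˡ _ fi≡t
anyF-intro f (Fin.suc i) fi≡t = ∨-introʳ (f Fin.zero) (anyF-intro (λ j → f (Fin.suc j)) i fi≡t)

anyF-witness : ∀ {n} (f : Fin n → Bool) → anyF f ≡ true → ∃ λ i → f i ≡ true
anyF-witness {suc n} f any≡t with ∨-elim (f Fin.zero) any≡t
... | inj₁ f0≡t = Fin.zero , f0≡t
... | inj₂ rest with anyF-witness (λ j → f (Fin.suc j)) rest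
...   | i , fi≡t = Fin.suc i , fi≡t

anyF-none : ∀ {n} (f : Fin n → Bool) → (∀ i → f i ≡ false) → anyF f ≡ false
anyF-none {zero}  f _    = refl
anyF-none {suc n} f none rewrite none Fin.zero = anyF-none (λ i → f (Fin.suc i)) (λ i → none (Fin.suc i))

allF-intro : ∀ {n} (f : Fin n → Bool) → (∀ i → f i ≡ true) → allF f ≡ true
allF-intro {zero}  f _   = refl
allF-intro {suc n} f all = ∧-intro (all Fin.zero) (allF-intro (λ j → f (Fin.suc j)) (λ j → all (Fin.suc j)))

allF-elim : ∀ {n} (f : Fin n → Bool) → allF f ≡ true → ∀ i → f i ≡ true
allF-elim f all≡t Fin.zero    = ∧-elimˡ (f Fin.zero) all≡t
allF-elim f all≡t (Fin.suc i) = allF-elim (λ j → f (Fin.suc j)) (∧-elimʳ (f Fin.zero) all≡t) i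

anyF-≗ : ∀ {n} {f g : Fin n → Bool} → f ≗ g → anyF f ≡ anyF g
anyF-≗ {zero}  _   = refl
anyF-≗ {suc n} f≗g = cong₂ _∨_ (f≗g Fin.zero) (anyF-≗ (λ j → f≗g (Fin.suc j)))

allF-≗ : ∀ {n} {f g : Fin n → Bool} → f ≗ g → allF f ≡ allF g
allF-≗ {zero}  _   = refl
allF-≗ {suc n} f≗g = cong₂ _∧_ (f≗g Fin.zero) (allF-≗ (λ j → f≗g (Fin.suc j)))

==-refl : ∀ {n} (u : Fin n) → (u == u) ≡ true
==-refl u = dec-true (u Fin.≟ u) refl

==-≢ : ∀ {n} {u v : Fin n} → u ≢ v → (u == v) ≡ false
==-≢ {u = u} {v} u≢v = dec-false (u Fin.≟ v) u≢v

==⇒≡ : ∀ {n} (u v : Fin n) → (u == v) ≡ true → u ≡ v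
==⇒≡ u v u==v with u Fin.≟ v
... | yes u≡v = u≡v

reach-≗ : ∀ G {S T : Subset (size G)} → S ≗ T → ∀ k u v → reach G S k u v ≡ reach G T k u v
reach-≗ G S≗T zero    u v = cong ((u == v) ∧_) (S≗T u)
reach-≗ G S≗T (suc k) u v =
  cong₂ _∨_ (reach-≗ G S≗T k u v)
    (anyF-≗ (λ w → cong₂ _∧_ (S≗T w) (cong (_∧ adj G w v) (reach-≗ G S≗T k u w))))

inducesConnected-≗ : ∀ G {S T : Subset (size G)} → S ≗ T → inducesConnected G S ≡ inducesConnected G T
inducesConnected-≗ G S≗T = cong₂ _∧_ (anyF-≗ S≗T)
  (allF-≗ (λ u → allF-≗ (λ v →
     cong₂ _∨_ (cong not (cong₂ _∧_ (S≗T u) (S≗T v))) (reach-≗ G S≗T (size G) u v))))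

reach-suc : ∀ G S k u v → reach G S k u v ≡ true → reach G S (suc k) u v ≡ true
reach-suc G S k u v = ∨-introˡ _

reach-mono : ∀ G S {k k′} u v → k ≤ k′ → reach G S k u v ≡ true → reach G S k′ u v ≡ true
reach-mono G S u v k≤k′ walk with ℕₚ.m≤n⇒m<n∨m≡n k≤k′
... | inj₂ refl                    = walk
... | inj₁ (s≤s {n = k″} k≤k″) = reach-suc G S k″ u v (reach-mono G S u v k≤k″ walk)

_⊆_ : ∀ {n} → Subset n → Subset n → Set
A ⊆ B = ∀ i → A i ≡ true → B i ≡ true

card-≤ : ∀ {n} (A : Subset n) → card A ≤ n
card-≤ {zero}  A = z≤n
card-≤ {suc n} A with A Fin.zero
... | true  = s≤s (card-≤ (λ i → A (Fin.suc i)))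
... | false = ℕₚ.m≤n⇒m≤1+n (card-≤ (λ i → A (Fin.suc i)))

card-mono : ∀ {n} (A B : Subset n) → A ⊆ B → card A ≤ card B
card-mono {zero}  A B _   = z≤n
card-mono {suc n} A B A⊆B with A Fin.zero in A0 | B Fin.zero in B0
... | true  | true  = s≤s (card-mono _ _ (λ i → A⊆B (Fin.suc i)))
... | true  | false with () ← trans (sym (A⊆B Fin.zero A0)) B0
... | false | true  = ℕₚ.m≤n⇒m≤1+n (card-mono _ _ (λ i → A⊆B (Fin.suc i)))
... | false | false = card-mono _ _ (λ i → A⊆B (Fin.suc i))

card-< : ∀ {n} (A B : Subset n) → A ⊆ B → ∀ i → A i ≡ false → B i ≡ true → card A < card B
card-< {suc n} A B A⊆B Fin.zero Ai≡f Bi≡t rewrite Ai≡f | Bi≡t =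
  s≤s (card-mono _ _ (λ i → A⊆B (Fin.suc i)))
card-< {suc n} A B A⊆B (Fin.suc i) Ai≡f Bi≡t with A Fin.zero in A0 | B Fin.zero in B0
... | true  | true  = s≤s (card-< _ _ (λ j → A⊆B (Fin.suc j)) i Ai≡f Bi≡t)
... | true  | false with () ← trans (sym (A⊆B Fin.zero A0)) B0
... | false | true  = ℕₚ.m≤n⇒m≤1+n (card-< _ _ (λ j → A⊆B (Fin.suc j)) i Ai≡f Bi≡t)
... | false | false = card-< _ _ (λ j → A⊆B (Fin.suc j)) i Ai≡f Bi≡t

⊆-or-witness : ∀ {n} (A B : Subset n) → A ⊆ B ⊎ ∃ λ i → A i ≡ true × B i ≡ false
⊆-or-witness {zero}  A B = inj₁ (λ ())
⊆-or-witness {suc n} A B with ⊆-or-witness (λ i → A (Fin.suc i)) (λ i → B (Fin.suc i))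
... | inj₂ (i , Ai≡t , Bi≡f) = inj₂ (Fin.suc i , Ai≡t , Bi≡f)
... | inj₁ tail⊆ with A Fin.zero in A0 | B Fin.zero in B0
...   | true  | false = inj₂ (Fin.zero , A0 , B0)
...   | true  | true  = inj₁ λ { Fin.zero _ → B0 ; (Fin.suc i) → tail⊆ i }
...   | false | _     = inj₁ λ { Fin.zero A0≡t → case trans (sym A0) A0≡t of λ ()
                               ; (Fin.suc i) → tail⊆ i }

-- The sets reachable from u in k steps grow with k; each strict growth adds a
-- vertex, so they are stable from step size G on.
module _ (G : Graph) (S : Subset (size G)) (u : Fin (size G)) where
  private
    Reach : ℕ → Subset (size G)
    Reach k v = reach G S k u v

    Stable : ℕ → Set
    Stable k = Reach (suc k) ⊆ Reach k

    stable-step : ∀ k → Stable k → Stable (suc k)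
    stable-step k stable v walk with ∨-elim (Reach (suc k) v) walk
    ... | inj₁ shorter = shorter
    ... | inj₂ step with anyF-witness _ step
    ...   | w , Sw∧walk∧edge =
      let walk∧edge = ∧-elimʳ (S w) Sw∧walk∧edge
      in ∨-introʳ (Reach k v) (anyF-intro _ w (∧-intro (∧-elimˡ (S w) Sw∧walk∧edge)
           (∧-intro (stable w (∧-elimˡ (Reach (suc k) w) walk∧edge)) (∧-elimʳ (Reach (suc k) w) walk∧edge))))

    stable-after : ∀ k → Stable k → ∀ t → Reach (t ℕ.+ k) ⊆ Reach k
    stable-after k stable t = go t
      where
      stable-from : ∀ t → Stable (t ℕ.+ k)
      stable-from zero    = stable
      stable-from (suc t) = stable-step (t ℕ.+ k) (stable-from t)
      go : ∀ t → Reach (t ℕ.+ k) ⊆ Reach k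
      go zero    v walk = walk
      go (suc t) v walk = go t v (stable-from t v walk)

    grows-or-stabilises : ∀ k → k ≤ card (Reach k) ⊎ ∃ λ i → i < k × Stable i
    grows-or-stabilises zero = inj₁ z≤n
    grows-or-stabilises (suc k) with grows-or-stabilises k
    ... | inj₂ (i , i<k , stable) = inj₂ (i , ℕₚ.m<n⇒m<1+n i<k , stable)
    ... | inj₁ k≤card with ⊆-or-witness (Reach (suc k)) (Reach k)
    ...   | inj₁ stable = inj₂ (k , ℕₚ.≤-refl , stable)
    ...   | inj₂ (v , new , old) = inj₁ (ℕₚ.<-≤-trans (s≤s k≤card)
              (card-< (Reach k) (Reach (suc k)) (λ w → reach-suc G S k u w) v old new))

  reach-saturates : ∀ k v → reach G S k u v ≡ true → reach G S (size G) u v ≡ true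
  reach-saturates k v walk with grows-or-stabilises (suc (size G))
  ... | inj₁ n<card = ⊥-elim (ℕₚ.<-irrefl refl (ℕₚ.<-≤-trans n<card (card-≤ (Reach (suc (size G))))))
  ... | inj₂ (i , s≤s i≤n , stable) = reach-mono G S u v i≤n (within-i k walk)
    where
    within-i : ∀ k → Reach k v ≡ true → Reach i v ≡ true
    within-i k with ℕₚ.≤-total k i
    ... | inj₁ k≤i = reach-mono G S u v k≤i
    ... | inj₂ i≤k = λ walk → stable-after i stable (k ℕ.∸ i) v
                       (subst (λ m → Reach m v ≡ true) (sym (ℕₚ.m∸n+n≡m i≤k)) walk)

InducesConnected : (G : Graph) → Subset (size G) → Set
InducesConnected G S =
  (∃ λ u → S u ≡ true) ×
  (∀ u v → S u ≡ true → S v ≡ true → ∃ λ k → reach G S k u v ≡ true)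

inducesConnected-sound : ∀ G S → inducesConnected G S ≡ true → InducesConnected G S
inducesConnected-sound G S conn =
  anyF-witness S (∧-elimˡ (anyF S) conn) ,
  λ u v Su Sv → size G , walk Su Sv (allF-elim _ (allF-elim _ (∧-elimʳ (anyF S) conn) u) v)
  where
  walk : ∀ {u v} → S u ≡ true → S v ≡ true →
         (not (S u ∧ S v) ∨ reach G S (size G) u v) ≡ true → reach G S (size G) u v ≡ true
  walk Su Sv clause rewrite Su | Sv = clause

inducesConnected-complete : ∀ G S → InducesConnected G S → inducesConnected G S ≡ true
inducesConnected-complete G S ((u , Su) , walks) =
  ∧-intro (anyF-intro S u Su) (allF-intro _ (λ u → allF-intro _ (λ v → clause u v)))
  where
  clause : ∀ u v → (not (S u ∧ S v) ∨ reach G S (size G) u v) ≡ true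
  clause u v with S u in Su | S v in Sv
  ... | true  | true  = let k , walk = walks u v Su Sv in reach-saturates G S u k v walk
  ... | true  | false = refl
  ... | false | _     = refl

inducesConnected-≡ : ∀ G S H T → (InducesConnected G S → InducesConnected H T) →
                     (InducesConnected H T → InducesConnected G S) →
                     inducesConnected G S ≡ inducesConnected H T
inducesConnected-≡ G S H T to from = ≡-from-⇔true
  (λ conn → inducesConnected-complete H T (to (inducesConnected-sound G S conn)))
  (λ conn → inducesConnected-complete G S (from (inducesConnected-sound H T conn)))

-- Node reliability as an expectation

infixr 5 _◂_
_◂_ : ∀ {n} → Bool → Subset n → Subset (suc n)
(b ◂ S) Fin.zero    = b
(b ◂ S) (Fin.suc i) = S i

-- expect n c x is the expected value of c S for a random S ⊆ Fin n that
-- contains each element independently with probability x.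
expect : (n : ℕ) → (Subset n → ℚ) → ℚ → ℚ
expect zero    c x = c (λ ())
expect (suc n) c x = (1ℚ - x) * expect n (λ S → c (false ◂ S)) x + x * expect n (λ S → c (true ◂ S)) x

-- Subsets are functions, so without function extensionality every integrand
-- has to be shown to respect pointwise equality.
Extensional : ∀ {n} → (Subset n → ℚ) → Set
Extensional c = ∀ {S T} → S ≗ T → c S ≡ c T

◂-≗ : ∀ {n} b {S T : Subset n} → S ≗ T → b ◂ S ≗ b ◂ T
◂-≗ b S≗T Fin.zero    = refl
◂-≗ b S≗T (Fin.suc i) = S≗T i

extensional-◂ : ∀ {n} {c : Subset (suc n) → ℚ} b → Extensional c → Extensional (λ S → c (b ◂ S))
extensional-◂ b ext S≗T = ext (◂-≗ b S≗T)

expect-cong : ∀ n {c d : Subset n → ℚ} x → (∀ S → c S ≡ d S) → expect n c x ≡ expect n d x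
expect-cong zero    x c≡d = c≡d _
expect-cong (suc n) x c≡d =
  cong₂ _+_ (cong ((1ℚ - x) *_) (expect-cong n x (λ S → c≡d (false ◂ S))))
            (cong (x *_) (expect-cong n x (λ S → c≡d (true ◂ S))))

expect-const : ∀ n a x → expect n (λ _ → a) x ≡ a
expect-const zero    a x = refl
expect-const (suc n) a x rewrite expect-const n a x = split a x
  where
  split : ∀ a x → (1ℚ - x) * a + x * a ≡ a
  split = solve-∀ ℚ-ring

sumℚ-++ : ∀ xs ys → sumℚ (xs ++ ys) ≡ sumℚ xs + sumℚ ys
sumℚ-++ []       ys = sym (ℚₚ.+-identityˡ _)
sumℚ-++ (x ∷ xs) ys rewrite sumℚ-++ xs ys = sym (ℚₚ.+-assoc x _ _)

sumℚ-scale : ∀ {A : Set} a (g : A → ℚ) xs → sumℚ (map (λ s → a * g s) xs) ≡ a * sumℚ (map g xs)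
sumℚ-scale a g []       = sym (ℚₚ.*-zeroʳ a)
sumℚ-scale a g (x ∷ xs) rewrite sumℚ-scale a g xs = sym (ℚₚ.*-distribˡ-+ a (g x) _)

card-≗ : ∀ {n} {A B : Subset n} → A ≗ B → card A ≡ card B
card-≗ {zero}  _   = refl
card-≗ {suc n} A≗B =
  cong₂ ℕ._+_ (cong (λ b → if b then 1 else 0) (A≗B Fin.zero)) (card-≗ (λ i → A≗B (Fin.suc i)))

weight : ∀ n → ℚ → Subset n → ℚ
weight n x S = pow x (card S) * pow (1ℚ - x) (n ℕ.∸ card S)

weight-≗ : ∀ n x {S T : Subset n} → S ≗ T → weight n x S ≡ weight n x T
weight-≗ n x S≗T rewrite card-≗ S≗T = refl

weight-false : ∀ n x (S : Subset n) → weight (suc n) x (false ◂ S) ≡ (1ℚ - x) * weight n x S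
weight-false n x S rewrite ℕₚ.+-∸-assoc 1 (card-≤ S) =
  swap (pow x (card S)) (1ℚ - x) (pow (1ℚ - x) (n ℕ.∸ card S))
  where
  swap : ∀ a b c → a * (b * c) ≡ b * (a * c)
  swap = solve-∀ ℚ-ring

weight-true : ∀ n x (S : Subset n) → weight (suc n) x (true ◂ S) ≡ x * weight n x S
weight-true n x S = ℚₚ.*-assoc x (pow x (card S)) (pow (1ℚ - x) (n ℕ.∸ card S))

sum-subsets : ∀ n (c : Subset n → ℚ) x → Extensional c →
              sumℚ (map (λ S → c S * weight n x S) (subsets n)) ≡ expect n c x
sum-subsets zero    c x ext = trans (ℚₚ.+-identityʳ _) (trans (ℚₚ.*-identityʳ _) (ext (λ ())))
sum-subsets (suc n) c x ext =
  trans (cong sumℚ (Listₚ.map-++ term (map _ (subsets n)) (map _ (subsets n))))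
  (trans (sumℚ-++ (map term (map _ (subsets n))) (map term (map _ (subsets n))))
    (cong₂ _+_ (half false (1ℚ - x) (weight-false n x) (λ S → λ { Fin.zero → refl ; (Fin.suc i) → refl }))
               (half true x (weight-true n x) (λ S → λ { Fin.zero → refl ; (Fin.suc i) → refl }))))
  where
  term : Subset (suc n) → ℚ
  term S = c S * weight (suc n) x S
  half : ∀ {f : Subset n → Subset (suc n)} b a → (∀ S → weight (suc n) x (b ◂ S) ≡ a * weight n x S) →
         (∀ S → f S ≗ b ◂ S) →
         sumℚ (map term (map f (subsets n))) ≡ a * expect n (λ S → c (b ◂ S)) x
  half {f} b a weight-◂ f≗◂ = begin
    sumℚ (map term (map f (subsets n)))                              ≡⟨ cong sumℚ (sym (Listₚ.map-∘ (subsets n))) ⟩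
    sumℚ (map (λ S → term (f S)) (subsets n))                        ≡⟨ cong sumℚ (Listₚ.map-cong factor (subsets n)) ⟩
    sumℚ (map (λ S → a * (c (b ◂ S) * weight n x S)) (subsets n))    ≡⟨ sumℚ-scale a _ (subsets n) ⟩
    a * sumℚ (map (λ S → c (b ◂ S) * weight n x S) (subsets n))      ≡⟨ cong (a *_) (sum-subsets n _ x (extensional-◂ b ext)) ⟩
    a * expect n (λ S → c (b ◂ S)) x                                 ∎
    where
    open ≡-Reasoning
    swap : ∀ p q r → p * (q * r) ≡ q * (p * r)
    swap = solve-∀ ℚ-ring
    factor : ∀ S → term (f S) ≡ a * (c (b ◂ S) * weight n x S)
    factor S = trans (cong₂ _*_ (ext (f≗◂ S)) (trans (weight-≗ (suc n) x (f≗◂ S)) (weight-◂ S)))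
                     (swap (c (b ◂ S)) a (weight n x S))

indicator : Bool → ℚ
indicator b = if b then 1ℚ else 0ℚ

connectedIndicator : (G : Graph) → Subset (size G) → ℚ
connectedIndicator G S = indicator (inducesConnected G S)

N≡expect : ∀ G x → N G x ≡ expect (size G) (connectedIndicator G) x
N≡expect G x =
  trans (cong sumℚ (Listₚ.map-cong (λ S → if-as-product (inducesConnected G S) _) (subsets (size G))))
        (sum-subsets (size G) (connectedIndicator G) x
           (λ S≗T → cong indicator (inducesConnected-≗ G S≗T)))
  where
  if-as-product : ∀ b a → (if b then a else 0ℚ) ≡ indicator b * a
  if-as-product true  a = sym (ℚₚ.*-identityˡ a)
  if-as-product false a = sym (ℚₚ.*-zeroˡ a)

join : ∀ {l m} → Subset l → Subset m → Subset (l ℕ.+ m)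
join {l} A B i = [ A , B ]′ (splitAt l i)

join-◂ : ∀ {l m} b (A : Subset l) (B : Subset m) → join (b ◂ A) B ≗ b ◂ join A B
join-◂ b A B Fin.zero = refl
join-◂ {l} b A B (Fin.suc i) with splitAt l i
... | inj₁ _ = refl
... | inj₂ _ = refl

expect-join : ∀ l m (c : Subset (l ℕ.+ m) → ℚ) x → Extensional c →
              expect (l ℕ.+ m) c x ≡ expect l (λ A → expect m (λ B → c (join A B)) x) x
expect-join zero    m c x ext = refl
expect-join (suc l) m c x ext =
  cong₂ _+_ (cong ((1ℚ - x) *_) (half false)) (cong (x *_) (half true))
  where
  half : ∀ b → expect (l ℕ.+ m) (λ S → c (b ◂ S)) x ≡ expect l (λ A → expect m (λ B → c (join (b ◂ A) B)) x) x
  half b = trans (expect-join l m _ x (extensional-◂ b ext))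
                 (expect-cong l x (λ A → expect-cong m x (λ B → ext (λ i → sym (join-◂ b A B i)))))

-- The probability that a random subset of an l-set, with bias x, is nonempty.
hitProb : ℕ → ℚ → ℚ
hitProb l x = 1ℚ - pow (1ℚ - x) l

expect-anyF : ∀ l (h : Bool → ℚ) x →
  expect l (λ T → h (anyF T)) x ≡ pow (1ℚ - x) l * h false + hitProb l x * h true
expect-anyF zero h x = unit (h false) (h true)
  where
  unit : ∀ a b → a ≡ 1ℚ * a + (1ℚ - 1ℚ) * b
  unit = solve-∀ ℚ-ring
expect-anyF (suc l) h x rewrite expect-anyF l h x | expect-const l (h true) x =
  regroup (pow (1ℚ - x) l) (h false) (h true) x
  where
  regroup : ∀ P a b x → (1ℚ - x) * (P * a + (1ℚ - P) * b) + x * b ≡ ((1ℚ - x) * P) * a + (1ℚ - (1ℚ - x) * P) * b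
  regroup = solve-∀ ℚ-ring

-- In G[K_l] the copy K_l^u of the vertex u consists of the vertices combine u j.
blockHit : ∀ {n} l → Subset (n ℕ.* l) → Subset n
blockHit l T u = anyF (λ j → T (combine u j))

blockHit-≗ : ∀ {n} l {S T : Subset (n ℕ.* l)} → S ≗ T → blockHit {n} l S ≗ blockHit l T
blockHit-≗ l S≗T u = anyF-≗ (λ j → S≗T (combine u j))

blockHit-join : ∀ n l (A : Subset l) (B : Subset (n ℕ.* l)) → blockHit {suc n} l (join A B) ≗ anyF A ◂ blockHit l B
blockHit-join n l A B Fin.zero    = anyF-≗ (λ j → cong [ A , B ]′ (Finₚ.splitAt-↑ˡ l j (n ℕ.* l)))
blockHit-join n l A B (Fin.suc u) = anyF-≗ (λ j → cong [ A , B ]′ (Finₚ.splitAt-↑ʳ l (n ℕ.* l) (combine u j)))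

expect-blocks : ∀ n l (C : Subset n → ℚ) x → Extensional C →
  expect (n ℕ.* l) (λ T → C (blockHit l T)) x ≡ expect n C (hitProb l x)
expect-blocks zero    l C x ext = ext (λ ())
expect-blocks (suc n) l C x ext = begin
  expect (l ℕ.+ n ℕ.* l) (λ T → C (blockHit l T)) x
    ≡⟨ expect-join l (n ℕ.* l) _ x (λ S≗T → ext (blockHit-≗ l S≗T)) ⟩
  expect l (λ A → expect (n ℕ.* l) (λ B → C (blockHit l (join A B))) x) x
    ≡⟨ expect-cong l x (λ A → expect-cong (n ℕ.* l) x (λ B → ext (blockHit-join n l A B))) ⟩
  expect l (λ A → expect (n ℕ.* l) (λ B → C (anyF A ◂ blockHit l B)) x) x
    ≡⟨ expect-cong l x (λ A → expect-blocks n l _ x (extensional-◂ (anyF A) ext)) ⟩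
  expect l (λ A → rest (anyF A)) x
    ≡⟨ expect-anyF l rest x ⟩
  P * rest false + (1ℚ - P) * rest true
    ≡⟨ cong (λ a → a * rest false + (1ℚ - P) * rest true) (complement P) ⟩
  (1ℚ - (1ℚ - P)) * rest false + (1ℚ - P) * rest true
    ∎
  where
  open ≡-Reasoning
  P : ℚ
  P = pow (1ℚ - x) l
  rest : Bool → ℚ
  rest b = expect n (λ S → C (b ◂ S)) (1ℚ - P)
  complement : ∀ P → P ≡ 1ℚ - (1ℚ - P)
  complement = solve-∀ ℚ-ring

expect-prob : ∀ n (c : Subset n → ℚ) x → (∀ S → Prob (c S)) → Prob x → Prob (expect n c x)
expect-prob zero    c x c∈[0,1] _       = c∈[0,1] _
expect-prob (suc n) c x c∈[0,1] x∈[0,1] =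
  convex-prob x∈[0,1] (expect-prob n _ x (λ S → c∈[0,1] _) x∈[0,1]) (expect-prob n _ x (λ S → c∈[0,1] _) x∈[0,1])

expect-lipschitz : ∀ n (c : Subset n → ℚ) {x y} → (∀ S → Prob (c S)) → 0ℚ ≤ℚ x → x ≤ℚ y → y ≤ℚ 1ℚ →
                   Close (fromℕ n * (y - x)) (expect n c x) (expect n c y)
expect-lipschitz zero c {x} {y} _ _ _ _ =
  subst (λ ε → Close ε (c (λ ())) (c (λ ()))) (sym (ℚₚ.*-zeroˡ (y - x))) (close-refl ℚₚ.≤-refl)
expect-lipschitz (suc n) c {x} {y} c∈[0,1] 0≤x x≤y y≤1 =
  subst (λ ε → Close ε (expect (suc n) c x) (expect (suc n) c y)) (regroup (fromℕ n) (y - x))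
    (close-trans
      (convex-shift 0≤x x≤y y≤1 (expect-prob n _ x (λ S → c∈[0,1] _) x∈[0,1])
                                (expect-prob n _ x (λ S → c∈[0,1] _) x∈[0,1]))
      (convex-close (ℚₚ.≤-trans 0≤x x≤y , y≤1)
                    (expect-lipschitz n _ (λ S → c∈[0,1] _) 0≤x x≤y y≤1)
                    (expect-lipschitz n _ (λ S → c∈[0,1] _) 0≤x x≤y y≤1)))
  where
  x∈[0,1] : Prob x
  x∈[0,1] = 0≤x , ℚₚ.≤-trans x≤y y≤1
  regroup : ∀ L d → d + L * d ≡ (L + 1ℚ) * d
  regroup = solve-∀ ℚ-ring

-- The isolated vertex and the lexicographic product

==-suc : ∀ {n} (u v : Fin n) → (Fin.suc u == Fin.suc v) ≡ (u == v)
==-suc u v = does-⇔ (mk⇔ Finₚ.suc-injective (cong Fin.suc)) (Fin.suc u Fin.≟ Fin.suc v) (u Fin.≟ v)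

∧-∧-false : ∀ a b → a ∧ (b ∧ false) ≡ false
∧-∧-false a b = trans (cong (a ∧_) (Boolₚ.∧-zeroʳ b)) (Boolₚ.∧-zeroʳ a)

module _ (F : Graph) where
  private
    H : Graph
    H = addIsolated F
    m : ℕ
    m = size F

  reach-addIsolated-suc : ∀ b (S : Subset m) k u v →
                          reach H (b ◂ S) k (Fin.suc u) (Fin.suc v) ≡ reach F S k u v
  reach-addIsolated-suc b S zero    u v = cong (_∧ S u) (==-suc u v)
  reach-addIsolated-suc b S (suc k) u v =
    cong₂ _∨_ (reach-addIsolated-suc b S k u v)
      (cong₂ _∨_ (∧-∧-false b _)
         (anyF-≗ (λ w → cong (λ r → S w ∧ (r ∧ adj F w v)) (reach-addIsolated-suc b S k u w))))

  reach-addIsolated-zero : ∀ b (S : Subset m) k v → reach H (b ◂ S) k Fin.zero (Fin.suc v) ≡ false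
  reach-addIsolated-zero b S zero    v = refl
  reach-addIsolated-zero b S (suc k) v rewrite reach-addIsolated-zero b S k v =
    trans (cong₂ _∨_ (∧-∧-false b _) refl)
      (anyF-none _ (λ w → trans (cong (λ r → S w ∧ (r ∧ adj F w v)) (reach-addIsolated-zero b S k w))
                                (Boolₚ.∧-zeroʳ (S w))))

  inducesConnected-false◂ : ∀ S → inducesConnected H (false ◂ S) ≡ inducesConnected F S
  inducesConnected-false◂ S = inducesConnected-≡ H (false ◂ S) F S to from
    where
    to : InducesConnected H (false ◂ S) → InducesConnected F S
    to ((Fin.suc u , Su) , walks) = (u , Su) , λ u v Su Sv →
      let k , walk = walks (Fin.suc u) (Fin.suc v) Su Sv
      in k , trans (sym (reach-addIsolated-suc false S k u v)) walk
    from : InducesConnected F S → InducesConnected H (false ◂ S)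
    from ((u , Su) , walks) = (Fin.suc u , Su) , λ
      { (Fin.suc u) (Fin.suc v) Su Sv → let k , walk = walks u v Su Sv
                                        in k , trans (reach-addIsolated-suc false S k u v) walk }

  inducesConnected-true◂ : ∀ S → inducesConnected H (true ◂ S) ≡ not (anyF S)
  inducesConnected-true◂ S = ≡-from-⇔true to from
    where
    to : inducesConnected H (true ◂ S) ≡ true → not (anyF S) ≡ true
    to conn with anyF S in any
    ... | false = refl
    ... | true with anyF-witness S any
    ...   | v , Sv with k , walk ← proj₂ (inducesConnected-sound H (true ◂ S) conn) Fin.zero (Fin.suc v) refl Sv
          with () ← trans (sym walk) (reach-addIsolated-zero true S k v)
    from : not (anyF S) ≡ true → inducesConnected H (true ◂ S) ≡ true
    from none = inducesConnected-complete H (true ◂ S) ((Fin.zero , refl) , walks)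
      where
      walks : ∀ u v → (true ◂ S) u ≡ true → (true ◂ S) v ≡ true → ∃ λ k → reach H (true ◂ S) k u v ≡ true
      walks Fin.zero    Fin.zero    _ _ = 0 , refl
      walks Fin.zero    (Fin.suc v) _ Sv with () ← trans (sym (cong not (anyF-intro S v Sv))) none
      walks (Fin.suc u) _           Su _ with () ← trans (sym (cong not (anyF-intro S u Su))) none

  N-addIsolated : ∀ x → N H x ≡ (1ℚ - x) * N F x + x * pow (1ℚ - x) m
  N-addIsolated x =
    trans (N≡expect H x) (cong₂ (λ a b → (1ℚ - x) * a + x * b) isolated-absent isolated-present)
    where
    isolated-absent : expect m (λ S → connectedIndicator H (false ◂ S)) x ≡ N F x
    isolated-absent = trans (expect-cong m x (λ S → cong indicator (inducesConnected-false◂ S)))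
                            (sym (N≡expect F x))
    simplify : ∀ P → P * 1ℚ + (1ℚ - P) * 0ℚ ≡ P
    simplify = solve-∀ ℚ-ring
    isolated-present : expect m (λ S → connectedIndicator H (true ◂ S)) x ≡ pow (1ℚ - x) m
    isolated-present = trans (expect-cong m x (λ S → cong indicator (inducesConnected-true◂ S)))
                         (trans (expect-anyF m (λ b → indicator (not b)) x) (simplify (pow (1ℚ - x) m)))

module _ (G : Graph) (l : ℕ) where
  private
    L : Graph
    L = lexK G l
    n : ℕ
    n = size G

    block : Fin (n ℕ.* l) → Fin n
    block x = proj₁ (remQuot {n} l x)

    position : Fin (n ℕ.* l) → Fin l
    position x = proj₂ (remQuot {n} l x)

    adj-lexK : ∀ x y → adj L x y ≡ (((block x == block y) ∧ not (position x == position y)) ∨ adj G (block x) (block y))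
    adj-lexK x y with remQuot {n} l x | remQuot {n} l y
    ... | _ | _ = refl

    block-combine : ∀ u j → block (combine u j) ≡ u
    block-combine u j = cong proj₁ (Finₚ.remQuot-combine u j)

    combine-block : ∀ x → combine (block x) (position x) ≡ x
    combine-block x = Finₚ.combine-remQuot {n} l x

  module _ (T : Subset (n ℕ.* l)) where
    private
      T̂ : Subset n
      T̂ = blockHit {n} l T

      hit : ∀ x → T x ≡ true → T̂ (block x) ≡ true
      hit x Tx = anyF-intro _ (position x) (trans (cong T (combine-block x)) Tx)

      walk-project : ∀ k x y → reach L T k x y ≡ true → reach G T̂ k (block x) (block y) ≡ true
      walk-project zero x y walk with ==⇒≡ x y (∧-elimˡ (x == y) walk)
      ... | refl = ∧-intro (==-refl (block x)) (hit x (∧-elimʳ (x == x) walk))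
      walk-project (suc k) x y walk with ∨-elim (reach L T k x y) walk
      ... | inj₁ shorter = reach-suc G T̂ k _ _ (walk-project k x y shorter)
      ... | inj₂ step with anyF-witness _ step
      ...   | w , Tw∧walk∧edge with ∧-elimˡ (T w) Tw∧walk∧edge
                                  | ∧-elimˡ (reach L T k x w) (∧-elimʳ (T w) Tw∧walk∧edge)
                                  | ∧-elimʳ (reach L T k x w) (∧-elimʳ (T w) Tw∧walk∧edge)
      ...     | Tw | walk-xw | edge
              with ∨-elim ((block w == block y) ∧ not (position w == position y)) (trans (sym (adj-lexK w y)) edge)
      ...       | inj₁ same-block = reach-suc G T̂ k _ _
                    (subst (λ z → reach G T̂ k (block x) z ≡ true)
                           (==⇒≡ _ _ (∧-elimˡ (block w == block y) same-block)) (walk-project k x w walk-xw))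
      ...       | inj₂ block-edge = ∨-introʳ _ (anyF-intro _ (block w)
                    (∧-intro (hit w Tw) (∧-intro (walk-project k x w walk-xw) block-edge)))

      walk-lift : ∀ k u v → reach G T̂ k u v ≡ true → ∀ x y → T x ≡ true → T y ≡ true →
                  block x ≡ u → block y ≡ v → reach L T (suc k) x y ≡ true
      walk-lift zero u v walk x y Tx Ty bx by with ==⇒≡ u v (∧-elimˡ (u == v) walk)
      ... | refl with x Fin.≟ y
      ...   | yes refl = ∨-introˡ _ Tx
      ...   | no x≢y   = ∨-introʳ _ (anyF-intro _ x (∧-intro Tx (∧-intro (∧-intro (==-refl x) Tx) edge)))
        where
        same-block : block x ≡ block y
        same-block = trans bx (sym by)
        edge : adj L x y ≡ true
        edge = trans (adj-lexK x y) (∨-introˡ _ (∧-intro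
                 (subst (λ z → (block x == z) ≡ true) same-block (==-refl (block x)))
                 (cong not (==-≢ λ pos≡ → x≢y (trans (sym (combine-block x))
                   (trans (cong₂ combine same-block pos≡) (combine-block y)))))))
      walk-lift (suc k) u v walk x y Tx Ty bx by with ∨-elim (reach G T̂ k u v) walk
      ... | inj₁ shorter = reach-suc L T (suc k) x y (walk-lift k u v shorter x y Tx Ty bx by)
      ... | inj₂ step with anyF-witness _ step
      ...   | w , T̂w∧walk∧edge with anyF-witness _ (∧-elimˡ (T̂ w) T̂w∧walk∧edge)
                                  | ∧-elimˡ (reach G T̂ k u w) (∧-elimʳ (T̂ w) T̂w∧walk∧edge)
                                  | ∧-elimʳ (reach G T̂ k u w) (∧-elimʳ (T̂ w) T̂w∧walk∧edge)
      ...     | j , Twj | walk-uw | edge-wv =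
        ∨-introʳ _ (anyF-intro _ (combine w j)
          (∧-intro Twj (∧-intro (walk-lift k u w walk-uw x (combine w j) Tx Twj bx (block-combine w j)) edge)))
        where
        edge : adj L (combine w j) y ≡ true
        edge = trans (adj-lexK (combine w j) y)
          (∨-introʳ _ (subst₂ (λ a b → adj G a b ≡ true) (sym (block-combine w j)) (sym by) edge-wv))

    inducesConnected-lexK : inducesConnected L T ≡ inducesConnected G T̂
    inducesConnected-lexK = inducesConnected-≡ L T G T̂ to from
      where
      to : InducesConnected L T → InducesConnected G T̂
      to ((x , Tx) , walks) = (block x , hit x Tx) , λ u v T̂u T̂v →
        let i , Tui = anyF-witness _ T̂u
            j , Tvj = anyF-witness _ T̂v
            k , walk = walks _ _ Tui Tvj
        in k , subst₂ (λ a b → reach G T̂ k a b ≡ true) (block-combine u i) (block-combine v j)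
                      (walk-project k _ _ walk)
      from : InducesConnected G T̂ → InducesConnected L T
      from ((u , T̂u) , walks) =
        let j , Tuj = anyF-witness (λ j → T (combine u j)) T̂u
        in (combine u j , Tuj) , λ x y Tx Ty →
             let k , walk = walks _ _ (hit x Tx) (hit y Ty)
             in suc k , walk-lift k _ _ walk x y Tx Ty refl refl

  N-lexK : ∀ x → N L x ≡ N G (hitProb l x)
  N-lexK x = begin
    N L x                                                           ≡⟨ N≡expect L x ⟩
    expect (n ℕ.* l) (connectedIndicator L) x                       ≡⟨ expect-cong (n ℕ.* l) x
                                                                         (λ T → cong indicator (inducesConnected-lexK T)) ⟩
    expect (n ℕ.* l) (λ T → connectedIndicator G (blockHit l T)) x  ≡⟨ expect-blocks n l (connectedIndicator G) x
                                                                         (λ S≗T → cong indicator (inducesConnected-≗ G S≗T)) ⟩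
    expect n (connectedIndicator G) (hitProb l x)                   ≡⟨ sym (N≡expect G _) ⟩
    N G (hitProb l x)                                               ∎
    where open ≡-Reasoning

N-addIsolated-lexK : ∀ G l x → N (addIsolated (lexK G l)) x ≡
                     (1ℚ - x) * N G (hitProb l x) + x * pow (1ℚ - x) (size G ℕ.* l)
N-addIsolated-lexK G l x =
  trans (N-addIsolated (lexK G l) x) (cong (λ p → (1ℚ - x) * p + x * pow (1ℚ - x) (size G ℕ.* l)) (N-lexK G l x))

indicator-prob : ∀ b → Prob (indicator b)
indicator-prob true  = 0≤1 , ℚₚ.≤-refl
indicator-prob false = ℚₚ.≤-refl , 0≤1

N-prob : ∀ G {x} → Prob x → Prob (N G x)
N-prob G {x} x∈[0,1] = subst Prob (sym (N≡expect G x))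
  (expect-prob (size G) _ x (λ S → indicator-prob (inducesConnected G S)) x∈[0,1])

N-lipschitz : ∀ G {x y} → 0ℚ ≤ℚ x → x ≤ℚ y → y ≤ℚ 1ℚ → Close (fromℕ (size G) * (y - x)) (N G x) (N G y)
N-lipschitz G {x} {y} 0≤x x≤y y≤1 =
  subst₂ (Close (fromℕ (size G) * (y - x))) (sym (N≡expect G x)) (sym (N≡expect G y))
    (expect-lipschitz (size G) _ (λ S → indicator-prob (inducesConnected G S)) 0≤x x≤y y≤1)

-- The construction

parity : ∀ i → Odd i ⊎ Even i
parity zero          = inj₂ refl
parity (suc zero)    = inj₁ refl
parity (suc (suc i)) = parity i

odd⇒¬even : ∀ {i} → Odd i → Even i → ⊥
odd⇒¬even odd even with () ← trans (sym odd) even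

odd-suc⇒even : ∀ i → Odd (suc i) → Even i
odd-suc⇒even zero          _   = refl
odd-suc⇒even (suc (suc i)) odd = odd-suc⇒even i odd

chain-≤ : ∀ (f : ℕ → ℚ) k → (∀ i → 1 ≤ i → i < k → f i <ℚ f (suc i)) →
          ∀ {i j} → 1 ≤ i → i ≤ j → j ≤ k → f i ≤ℚ f j
chain-≤ f k increasing {i} {j} 1≤i i≤j j≤k with ℕₚ.m≤n⇒m<n∨m≡n i≤j
... | inj₂ refl = ℚₚ.≤-refl
... | inj₁ (s≤s {n = j′} i≤j′) =
  ℚₚ.≤-trans (chain-≤ f k increasing 1≤i i≤j′ (ℕₚ.<⇒≤ j≤k))
             (ℚₚ.<⇒≤ (increasing j′ (ℕₚ.≤-trans 1≤i i≤j′) j≤k))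

pow-one : ∀ k → pow 1ℚ k ≡ 1ℚ
pow-one zero    = refl
pow-one (suc k) = trans (ℚₚ.*-identityˡ _) (pow-one k)

hitProb-zero : ∀ l → hitProb l 0ℚ ≡ 0ℚ
hitProb-zero l = cong (λ p → 1ℚ - p) (pow-one l)

hitProb-mono : ∀ l {x y} → 0ℚ ≤ℚ x → x ≤ℚ y → y ≤ℚ 1ℚ → hitProb l x ≤ℚ hitProb l y
hitProb-mono l {x} {y} 0≤x x≤y y≤1 =
  ≤-by-difference (pow (1ℚ - x) l - pow (1ℚ - y) l) (swap (pow (1ℚ - x) l) (pow (1ℚ - y) l))
    (x≤y⇒0≤y-x (pow-mono l (x≤y⇒0≤y-x y≤1) (≤-by-difference (y - x) (swap y x) (x≤y⇒0≤y-x x≤y))))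
  where
  swap : ∀ a b → (1ℚ - b) - (1ℚ - a) ≡ a - b
  swap = solve-∀ ℚ-ring

hitProb-lipschitz : ∀ l {x y} → 0ℚ ≤ℚ x → x ≤ℚ y → y ≤ℚ 1ℚ →
                    hitProb l y ≤ℚ hitProb l x + fromℕ l * (y - x)
hitProb-lipschitz l {x} {y} 0≤x x≤y y≤1 =
  ≤-by-difference ((pow (1ℚ - y) l + fromℕ l * ((1ℚ - x) - (1ℚ - y))) - pow (1ℚ - x) l)
    (regroup (pow (1ℚ - x) l) (pow (1ℚ - y) l) (fromℕ l) x y)
    (x≤y⇒0≤y-x (pow-lipschitz l (x≤y⇒0≤y-x y≤1) (≤-by-difference (y - x) (swap x y) (x≤y⇒0≤y-x x≤y))
                                 (≤-by-difference x (cancel x) 0≤x)))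
  where
  regroup : ∀ Px Py L x y → ((1ℚ - Px) + L * (y - x)) - (1ℚ - Py) ≡ (Py + L * ((1ℚ - x) - (1ℚ - y))) - Px
  regroup = solve-∀ ℚ-ring
  swap : ∀ x y → (1ℚ - x) - (1ℚ - y) ≡ y - x
  swap = solve-∀ ℚ-ring
  cancel : ∀ x → 1ℚ - (1ℚ - x) ≡ x
  cancel = solve-∀ ℚ-ring

-- Bernoulli: (1-x)ˡ ≤ 1/(1 + l x), which is at most 1 - a once l x (1 - a) ≥ 1.
hitProb-≥ : ∀ l {x a} → Prob x → a ≤ℚ 1ℚ → 1ℚ ≤ℚ (fromℕ l * x) * (1ℚ - a) → a ≤ℚ hitProb l x
hitProb-≥ l {x} {a} x∈[0,1] a≤1 large =
  ≤-by-difference (Q * ((fromℕ l * x) * (1ℚ - a) - 1ℚ) + (1ℚ - a) * (1ℚ - Q * (1ℚ + fromℕ l * x)) + (1ℚ - a) * Q)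
    (expand Q (fromℕ l * x) a)
    (nonNeg+nonNeg (nonNeg+nonNeg (nonNeg*nonNeg 0≤Q (x≤y⇒0≤y-x large))
                                  (nonNeg*nonNeg (x≤y⇒0≤y-x a≤1) (x≤y⇒0≤y-x (bernoulli l x∈[0,1]))))
                   (nonNeg*nonNeg (x≤y⇒0≤y-x a≤1) 0≤Q))
  where
  Q : ℚ
  Q = pow (1ℚ - x) l
  0≤Q : 0ℚ ≤ℚ Q
  0≤Q = proj₁ (prob-pow l (prob-complement x∈[0,1]))
  expand : ∀ Q c a → (1ℚ - Q) - a ≡ Q * (c * (1ℚ - a) - 1ℚ) + (1ℚ - a) * (1ℚ - Q * (1ℚ + c)) + (1ℚ - a) * Q
  expand = solve-∀ ℚ-ring

mix-≤-double-complement : ∀ {x P J} → 1 ≤ J → Prob x → Prob P →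
                          (1ℚ - x) * P + x * pow (1ℚ - x) J ≤ℚ (1ℚ - x) + (1ℚ - x)
mix-≤-double-complement {x} {P} {suc J} _ x∈[0,1]@(_ , x≤1) (_ , P≤1) =
  ≤-by-difference ((1ℚ - x) * (1ℚ - P) + (1ℚ - x) * (1ℚ - x * pow (1ℚ - x) J)) (expand x P (pow (1ℚ - x) J))
    (nonNeg+nonNeg (nonNeg*nonNeg (x≤y⇒0≤y-x x≤1) (x≤y⇒0≤y-x P≤1))
                   (nonNeg*nonNeg (x≤y⇒0≤y-x x≤1)
                                  (x≤y⇒0≤y-x (proj₂ (prob-* x∈[0,1] (prob-pow J (prob-complement x∈[0,1])))))))
  where
  expand : ∀ x P Q → ((1ℚ - x) + (1ℚ - x)) - ((1ℚ - x) * P + x * ((1ℚ - x) * Q)) ≡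
           (1ℚ - x) * (1ℚ - P) + (1ℚ - x) * (1ℚ - x * Q)
  expand = solve-∀ ℚ-ring

<-suc-elim : ∀ {k} (P : ℕ → Set) → (∀ {i} → i < k → P i) → P k → ∀ {i} → i < suc k → P i
<-suc-elim P below last i<k+1 with ℕₚ.m<1+n⇒m<n∨m≡n i<k+1
... | inj₁ i<k  = below i<k
... | inj₂ refl = last

connected⇒nonempty : ∀ G → Connected G → 1 ≤ size G
connected⇒nonempty (mkGraph (suc n) _) _ = s≤s z≤n

last-of-odd-alternation-pos :
  ∀ (β : ℕ → ℚ) k → 1 ≤ k → Odd k → (∀ i → 1 ≤ i → i < k → Even i → β i <ℚ β (suc i)) →
  (∀ i → 1 ≤ i → i ≤ k → 0ℚ ≤ℚ β i) → 0ℚ <ℚ β 1 → 0ℚ <ℚ β k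
last-of-odd-alternation-pos β (suc zero)    _ _   _    _      0<β₁ = 0<β₁
last-of-odd-alternation-pos β (suc (suc k)) _ odd rise 0≤β _ =
  ℚₚ.≤-<-trans (0≤β (suc k) (s≤s z≤n) (ℕₚ.n≤1+n _))
               (rise (suc k) (s≤s z≤n) ℕₚ.≤-refl (odd-suc⇒even (suc k) odd))

module Construction
  (G : Graph) (connected : Connected G) (k : ℕ) (1≤k : 1 ≤ k) (k-odd : Odd k) (α : ℕ → ℚ)
  (0<α₁ : 0ℚ <ℚ α 1) (α-increasing : ∀ i → 1 ≤ i → i < k → α i <ℚ α (suc i)) (αₖ<1 : α k <ℚ 1ℚ)
  (0<β₁ : 0ℚ <ℚ N G (α 1))
  (β-odd : ∀ i → 1 ≤ i → i < k → Odd i → N G (α (suc i)) <ℚ N G (α i))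
  (β-even : ∀ i → 1 ≤ i → i < k → Even i → N G (α i) <ℚ N G (α (suc i)))
  where

  n : ℕ
  n = size G

  β : ℕ → ℚ
  β i = N G (α i)

  α-mono : ∀ {i j} → 1 ≤ i → i ≤ j → j ≤ k → α i ≤ℚ α j
  α-mono = chain-≤ α k α-increasing

  α-pos : ∀ {i} → 1 ≤ i → i ≤ k → 0ℚ <ℚ α i
  α-pos 1≤i i≤k = ℚₚ.<-≤-trans 0<α₁ (α-mono ℕₚ.≤-refl 1≤i i≤k)

  α-prob : ∀ {i} → 1 ≤ i → i ≤ k → Prob (α i)
  α-prob 1≤i i≤k =
    ℚₚ.<⇒≤ (α-pos 1≤i i≤k) , ℚₚ.<⇒≤ (ℚₚ.≤-<-trans (α-mono 1≤i i≤k ℕₚ.≤-refl) αₖ<1)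

  0<βₖ : 0ℚ <ℚ β k
  0<βₖ = last-of-odd-alternation-pos β k 1≤k k-odd β-even
           (λ i 1≤i i≤k → proj₁ (N-prob G (α-prob 1≤i i≤k))) 0<β₁

  βgap : ℕ → ℚ
  βgap i = [ (λ _ → β i - β (suc i)) , (λ _ → β (suc i) - β i) ]′ (parity i)

  βgap-odd : ∀ {i} → Odd i → βgap i ≡ β i - β (suc i)
  βgap-odd {i} odd with parity i
  ... | inj₁ _    = refl
  ... | inj₂ even = ⊥-elim (odd⇒¬even {i} odd even)

  βgap-even : ∀ {i} → Even i → βgap i ≡ β (suc i) - β i
  βgap-even {i} even with parity i
  ... | inj₁ odd = ⊥-elim (odd⇒¬even {i} odd even)
  ... | inj₂ _   = refl

  βgap-pos : ∀ i → 1 ≤ i → i < k → 0ℚ <ℚ βgap i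
  βgap-pos i 1≤i i<k with parity i
  ... | inj₁ odd  = x<y⇒0<y-x (β-odd i 1≤i i<k odd)
  ... | inj₂ even = x<y⇒0<y-x (β-even i 1≤i i<k even)

  gap : ℕ → ℚ
  gap i = βgap i ⊓ (α (suc i) - α i)

  gap-pos : ∀ i → 1 ≤ i → i < k → 0ℚ <ℚ gap i
  gap-pos i 1≤i i<k = pos⊓pos (βgap-pos i 1≤i i<k) (x<y⇒0<y-x (α-increasing i 1≤i i<k))

  gap-bound : ∃ λ δ → 0ℚ <ℚ δ × (∀ i → 1 ≤ i → i < k → δ ≤ℚ gap i)
  gap-bound = positive-lower-bound gap k gap-pos

  δ : ℚ
  δ = proj₁ gap-bound

  0<δ : 0ℚ <ℚ δ
  0<δ = proj₁ (proj₂ gap-bound)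

  δ≤gap : ∀ i → 1 ≤ i → i < k → δ ≤ℚ gap i
  δ≤gap = proj₂ (proj₂ gap-bound)

  μ : ℚ
  μ = δ ⊓ (β 1 ⊓ (β k ⊓ 1ℚ))

  0<μ : 0ℚ <ℚ μ
  0<μ = pos⊓pos 0<δ (pos⊓pos 0<β₁ (pos⊓pos 0<βₖ 0<1))

  μ≤δ : μ ≤ℚ δ
  μ≤δ = ℚₚ.p⊓q≤p δ _

  μ≤β₁ : μ ≤ℚ β 1
  μ≤β₁ = ℚₚ.≤-trans (ℚₚ.p⊓q≤q δ _) (ℚₚ.p⊓q≤p (β 1) _)

  μ≤βₖ : μ ≤ℚ β k
  μ≤βₖ = ℚₚ.≤-trans (ℚₚ.p⊓q≤q δ _) (ℚₚ.≤-trans (ℚₚ.p⊓q≤q (β 1) _) (ℚₚ.p⊓q≤p (β k) 1ℚ))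

  μ≤1 : μ ≤ℚ 1ℚ
  μ≤1 = ℚₚ.≤-trans (ℚₚ.p⊓q≤q δ _) (ℚₚ.≤-trans (ℚₚ.p⊓q≤q (β 1) _) (ℚₚ.p⊓q≤q (β k) 1ℚ))

  μ≤βgap : ∀ i → 1 ≤ i → i < k → μ ≤ℚ βgap i
  μ≤βgap i 1≤i i<k = ℚₚ.≤-trans μ≤δ (ℚₚ.≤-trans (δ≤gap i 1≤i i<k) (ℚₚ.p⊓q≤p _ _))

  ⅛ : ℚ
  ⅛ = ℤ.+ 1 ℚ./ 8

  -- ρ bounds both errors made at each α′ᵢ: the shift of the argument and the
  -- perturbation by the isolated vertex; ε = 2ρ is their sum.
  ρ : ℚ
  ρ = μ * ⅛

  ε : ℚ
  ε = ρ + ρ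

  0<ρ : 0ℚ <ℚ ρ
  0<ρ = pos*pos 0<μ (toWitness {a? = 0ℚ ℚₚ.<? ⅛} tt)

  0≤ε : 0ℚ ≤ℚ ε
  0≤ε = nonNeg+nonNeg (ℚₚ.<⇒≤ 0<ρ) (ℚₚ.<⇒≤ 0<ρ)

  ρ<1-ρ : ρ <ℚ 1ℚ - ρ
  ρ<1-ρ = <-by-difference ((1ℚ - (⅛ + ⅛)) + (⅛ + ⅛) * (1ℚ - μ)) (expand μ ⅛)
    (pos+nonNeg (toWitness {a? = 0ℚ ℚₚ.<? 1ℚ - (⅛ + ⅛)} tt)
                (nonNeg*nonNeg (toWitness {a? = 0ℚ ℚₚ.≤? ⅛ + ⅛} tt) (x≤y⇒0≤y-x μ≤1)))
    where
    expand : ∀ μ q → (1ℚ - μ * q) - μ * q ≡ (1ℚ - (q + q)) + (q + q) * (1ℚ - μ)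
    expand = solve-∀ ℚ-ring

  ρ-prob : Prob ρ
  ρ-prob =
    ℚₚ.<⇒≤ 0<ρ , ℚₚ.<⇒≤ (ℚₚ.<-≤-trans ρ<1-ρ (≤-by-difference ρ (cancel ρ) (ℚₚ.<⇒≤ 0<ρ)))
    where
    cancel : ∀ ρ → 1ℚ - (1ℚ - ρ) ≡ ρ
    cancel = solve-∀ ℚ-ring

  separated : ∀ {a b} → μ ≤ℚ a - b → b + (ε + ε) <ℚ a
  separated {a} {b} μ≤a-b =
    <-by-difference (((a - b) - μ) + μ * (1ℚ - ((⅛ + ⅛) + (⅛ + ⅛)))) (expand a b μ ⅛)
      (nonNeg+pos (x≤y⇒0≤y-x μ≤a-b) (pos*pos 0<μ (toWitness {a? = 0ℚ ℚₚ.<? 1ℚ - ((⅛ + ⅛) + (⅛ + ⅛))} tt)))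
    where
    expand : ∀ a b μ q → a - (b + ((μ * q + μ * q) + (μ * q + μ * q))) ≡
             ((a - b) - μ) + μ * (1ℚ - ((q + q) + (q + q)))
    expand = solve-∀ ℚ-ring

  1≤n : 1 ≤ n
  1≤n = connected⇒nonempty G connected

  0<n : 0ℚ <ℚ fromℕ n
  0<n = ℚₚ.<-≤-trans (fromℕ-pos 0) (fromℕ-mono 1≤n)

  instance
    n≢0 : ℚ.NonZero (fromℕ n)
    n≢0 = ℚₚ.pos⇒nonZero (fromℕ n) {{ℚ.positive 0<n}}

  η : ℚ
  η = δ ⊓ (ρ * 1/ fromℕ n)

  0<η : 0ℚ <ℚ η
  0<η = pos⊓pos 0<δ (pos*pos 0<ρ (ℚₚ.positive⁻¹ _ {{ℚₚ.1/pos⇒pos (fromℕ n) {{ℚ.positive 0<n}}}}))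

  n*η≤ρ : fromℕ n * η ≤ℚ ρ
  n*η≤ρ = begin
    fromℕ n * η                    ≤⟨ ℚₚ.*-monoˡ-≤-nonNeg (fromℕ n) {{ℚ.nonNegative (ℚₚ.<⇒≤ 0<n)}} (ℚₚ.p⊓q≤q δ _) ⟩
    fromℕ n * (ρ * 1/ fromℕ n)     ≡⟨ regroup (fromℕ n) ρ (1/ fromℕ n) ⟩
    ρ * (fromℕ n * 1/ fromℕ n)     ≡⟨ cong (ρ *_) (ℚₚ.*-inverseʳ (fromℕ n)) ⟩
    ρ * 1ℚ                         ≡⟨ ℚₚ.*-identityʳ ρ ⟩
    ρ                              ∎
    where
    open ℚₚ.≤-Reasoning
    regroup : ∀ a b c → a * (b * c) ≡ b * (a * c)
    regroup = solve-∀ ℚ-ring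

  α-gap : ∀ i → 1 ≤ i → i < k → α i + η ≤ℚ α (suc i)
  α-gap i 1≤i i<k = ≤-by-difference (((α (suc i) - α i) - δ) + (δ - η)) (expand (α i) (α (suc i)) δ η)
    (nonNeg+nonNeg (x≤y⇒0≤y-x (ℚₚ.≤-trans (δ≤gap i 1≤i i<k) (ℚₚ.p⊓q≤q (βgap i) _)))
                   (x≤y⇒0≤y-x (ℚₚ.p⊓q≤p δ _)))
    where
    expand : ∀ a a′ δ η → a′ - (a + η) ≡ ((a′ - a) - δ) + (δ - η)
    expand = solve-∀ ℚ-ring

  l-bound : ∃ λ m → 1ℚ ≤ℚ fromℕ m * (ρ * (1ℚ - α k))
  l-bound = archimedean 0<1 (pos*pos 0<ρ (x<y⇒0<y-x αₖ<1))

  l : ℕ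
  l = suc (proj₁ l-bound)

  αₖ≤hitProb : α k ≤ℚ hitProb l ρ
  αₖ≤hitProb = hitProb-≥ l ρ-prob (ℚₚ.<⇒≤ αₖ<1) (begin
    1ℚ                                       ≤⟨ proj₂ l-bound ⟩
    fromℕ (proj₁ l-bound) * (ρ * (1ℚ - α k)) ≤⟨ ℚₚ.*-monoʳ-≤-nonNeg (ρ * (1ℚ - α k))
                                                  {{ℚ.nonNegative (nonNeg*nonNeg (ℚₚ.<⇒≤ 0<ρ) (x≤y⇒0≤y-x (ℚₚ.<⇒≤ αₖ<1)))}}
                                                  (fromℕ-mono (ℕₚ.n≤1+n (proj₁ l-bound))) ⟩
    fromℕ l * (ρ * (1ℚ - α k))               ≡⟨ sym (ℚₚ.*-assoc (fromℕ l) ρ (1ℚ - α k)) ⟩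
    (fromℕ l * ρ) * (1ℚ - α k)               ∎)
    where open ℚₚ.≤-Reasoning

  preimage : Σ (ℚ → ℚ) λ g → ∀ {t} → hitProb l 0ℚ <ℚ t → t ≤ℚ hitProb l ρ →
               0ℚ <ℚ g t × g t ≤ℚ ρ × t ≤ℚ hitProb l (g t) × hitProb l (g t) <ℚ t + η
  preimage = approximate-preimage (hitProb l) 0<ρ (fromℕ-pos (proj₁ l-bound)) 0<η
               (λ {x} {y} 0≤x x≤y y≤ρ →
                  hitProb-lipschitz l {x} {y} 0≤x x≤y (ℚₚ.≤-trans y≤ρ (proj₂ ρ-prob)))

  pick : ℚ → ℚ
  pick = proj₁ preimage

  pick-spec : ∀ {i} → 1 ≤ i → i ≤ k → let x = pick (α i) in
    0ℚ <ℚ x × x ≤ℚ ρ × α i ≤ℚ hitProb l x × hitProb l x <ℚ α i + η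
  pick-spec 1≤i i≤k = proj₂ preimage (subst (_<ℚ _) (sym (hitProb-zero l)) (α-pos 1≤i i≤k))
                                     (ℚₚ.≤-trans (α-mono 1≤i i≤k ℕₚ.≤-refl) αₖ≤hitProb)

  α′ : ℕ → ℚ
  α′ i = if does (i ℕ.≤? k) then pick (α i) else 1ℚ - ρ

  α′-≤k : ∀ {i} → i ≤ k → α′ i ≡ pick (α i)
  α′-≤k {i} i≤k = cong (λ b → if b then pick (α i) else 1ℚ - ρ) (dec-true (i ℕ.≤? k) i≤k)

  α′-last : α′ (suc k) ≡ 1ℚ - ρ
  α′-last = cong (λ b → if b then pick (α (suc k)) else 1ℚ - ρ) (dec-false (suc k ℕ.≤? k) (ℕₚ.<-irrefl refl))

  H : Graph
  H = addIsolated (lexK G l)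

  module _ {i} (1≤i : 1 ≤ i) (i≤k : i ≤ k) where
    private
      x : ℚ
      x = pick (α i)
      spec : 0ℚ <ℚ x × x ≤ℚ ρ × α i ≤ℚ hitProb l x × hitProb l x <ℚ α i + η
      spec = pick-spec 1≤i i≤k

    x∈[0,1] : Prob x
    x∈[0,1] = ℚₚ.<⇒≤ (proj₁ spec) , ℚₚ.≤-trans (proj₁ (proj₂ spec)) (proj₂ ρ-prob)

    shift≤ρ : fromℕ n * (hitProb l x - α i) ≤ℚ ρ
    shift≤ρ = ℚₚ.≤-trans (ℚₚ.*-monoˡ-≤-nonNeg (fromℕ n) {{ℚ.nonNegative (ℚₚ.<⇒≤ 0<n)}}
                           (≤-by-difference ((α i + η) - hitProb l x) (regroup (α i) η (hitProb l x))
                              (x≤y⇒0≤y-x (ℚₚ.<⇒≤ (proj₂ (proj₂ (proj₂ spec)))))))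
                         n*η≤ρ
      where
      regroup : ∀ a η s → η - (s - a) ≡ (a + η) - s
      regroup = solve-∀ ℚ-ring

    β-close : Close ρ (β i) (N G (hitProb l x))
    β-close = close-weaken shift≤ρ
      (N-lipschitz G (proj₁ (α-prob 1≤i i≤k)) (proj₁ (proj₂ (proj₂ spec)))
                     (proj₂ (prob-complement (prob-pow l (prob-complement x∈[0,1])))))

    isolated-close : Close ρ (N G (hitProb l x)) ((1ℚ - x) * N G (hitProb l x) + x * pow (1ℚ - x) (n ℕ.* l))
    isolated-close = close-weaken (proj₁ (proj₂ spec))
      (mix-close x∈[0,1] (N-prob G (prob-complement (prob-pow l (prob-complement x∈[0,1]))))
                 (prob-pow (n ℕ.* l) (prob-complement x∈[0,1])))

    close-at : Close ε (β i) (N H (α′ i))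
    close-at = subst (Close ε (β i)) (sym (trans (cong (N H) (α′-≤k i≤k)) (N-addIsolated-lexK G l x)))
                     (close-trans β-close isolated-close)

  N-last≤ε : N H (α′ (suc k)) ≤ℚ ε
  N-last≤ε = begin
    N H (α′ (suc k))
      ≡⟨ trans (cong (N H) α′-last) (N-addIsolated-lexK G l (1ℚ - ρ)) ⟩
    (1ℚ - (1ℚ - ρ)) * N G (hitProb l (1ℚ - ρ)) + (1ℚ - ρ) * pow (1ℚ - (1ℚ - ρ)) (n ℕ.* l)
      ≤⟨ mix-≤-double-complement (ℕₚ.*-mono-≤ 1≤n (s≤s z≤n)) (prob-complement ρ-prob)
               (N-prob G (prob-complement (prob-pow l (prob-complement (prob-complement ρ-prob))))) ⟩
    (1ℚ - (1ℚ - ρ)) + (1ℚ - (1ℚ - ρ))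
      ≡⟨ cong₂ _+_ (cancel ρ) (cancel ρ) ⟩
    ε ∎
    where
    open ℚₚ.≤-Reasoning
    cancel : ∀ ρ → 1ℚ - (1ℚ - ρ) ≡ ρ
    cancel = solve-∀ ℚ-ring

  close-last : Close ε 0ℚ (N H (α′ (suc k)))
  close-last =
    nonNeg+nonNeg (proj₁ (N-prob H (subst Prob (sym α′-last) (prob-complement ρ-prob)))) 0≤ε ,
    subst (N H (α′ (suc k)) ≤ℚ_) (sym (ℚₚ.+-identityˡ ε)) N-last≤ε

  α′₁-pos : 0ℚ <ℚ α′ 1
  α′₁-pos = subst (0ℚ <ℚ_) (sym (α′-≤k 1≤k)) (proj₁ (pick-spec ℕₚ.≤-refl 1≤k))

  pick-increasing : ∀ i → 1 ≤ i → i < k → pick (α i) <ℚ pick (α (suc i))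
  pick-increasing i 1≤i i<k = ℚₚ.≰⇒> λ next≤this →
    ℚₚ.<-irrefl refl (ℚₚ.<-≤-trans hits-increase
      (hitProb-mono l (proj₁ (x∈[0,1] (s≤s z≤n) i<k)) next≤this (proj₂ (x∈[0,1] 1≤i (ℕₚ.<⇒≤ i<k)))))
    where
    hits-increase : hitProb l (pick (α i)) <ℚ hitProb l (pick (α (suc i)))
    hits-increase = ℚₚ.<-≤-trans (proj₂ (proj₂ (proj₂ (pick-spec 1≤i (ℕₚ.<⇒≤ i<k)))))
                      (ℚₚ.≤-trans (α-gap i 1≤i i<k) (proj₁ (proj₂ (proj₂ (pick-spec (s≤s z≤n) i<k)))))

  α′-final-step : α′ k <ℚ α′ (suc k)
  α′-final-step = subst₂ _<ℚ_ (sym (α′-≤k ℕₚ.≤-refl)) (sym α′-last)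
                    (ℚₚ.≤-<-trans (proj₁ (proj₂ (pick-spec 1≤k ℕₚ.≤-refl))) ρ<1-ρ)

  α′-step : ∀ i → 1 ≤ i → i < k → α′ i <ℚ α′ (suc i)
  α′-step i 1≤i i<k = subst₂ _<ℚ_ (sym (α′-≤k (ℕₚ.<⇒≤ i<k))) (sym (α′-≤k i<k)) (pick-increasing i 1≤i i<k)

  α′-increasing : ∀ i → 1 ≤ i → i < suc k → α′ i <ℚ α′ (suc i)
  α′-increasing i 1≤i i<k+1 =
    <-suc-elim (λ i → 1 ≤ i → α′ i <ℚ α′ (suc i))
      (λ i<k 1≤i → α′-step _ 1≤i i<k) (λ _ → α′-final-step) i<k+1 1≤i

  α′-last<1 : α′ (suc k) <ℚ 1ℚ
  α′-last<1 = subst (_<ℚ 1ℚ) (sym α′-last) (<-by-difference ρ (cancel ρ) 0<ρ)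
    where
    cancel : ∀ ρ → 1ℚ - (1ℚ - ρ) ≡ ρ
    cancel = solve-∀ ℚ-ring

  separated-from-0 : ∀ {a} → μ ≤ℚ a → 0ℚ + (ε + ε) <ℚ a
  separated-from-0 {a} μ≤a = separated {a} {0ℚ} (subst (μ ≤ℚ_) (sym (ℚₚ.+-identityʳ a)) μ≤a)

  N-first-pos : 0ℚ <ℚ N H (α′ 1)
  N-first-pos = close-separated (close-at ℕₚ.≤-refl 1≤k) (close-refl 0≤ε) (separated-from-0 μ≤β₁)

  N-odd : ∀ i → 1 ≤ i → i < suc k → Odd i → N H (α′ (suc i)) <ℚ N H (α′ i)
  N-odd i 1≤i i<k+1 = <-suc-elim (λ i → 1 ≤ i → Odd i → N H (α′ (suc i)) <ℚ N H (α′ i))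
    (λ {i} i<k 1≤i odd → close-separated (close-at 1≤i (ℕₚ.<⇒≤ i<k)) (close-at (s≤s z≤n) i<k)
                           (separated (subst (μ ≤ℚ_) (βgap-odd odd) (μ≤βgap i 1≤i i<k))))
    (λ _ _ → close-separated (close-at 1≤k ℕₚ.≤-refl) close-last (separated-from-0 μ≤βₖ))
    i<k+1 1≤i

  N-even : ∀ i → 1 ≤ i → i < suc k → Even i → N H (α′ i) <ℚ N H (α′ (suc i))
  N-even i 1≤i i<k+1 = <-suc-elim (λ i → 1 ≤ i → Even i → N H (α′ i) <ℚ N H (α′ (suc i)))
    (λ {i} i<k 1≤i even → close-separated (close-at (s≤s z≤n) i<k) (close-at 1≤i (ℕₚ.<⇒≤ i<k))
                            (separated (subst (μ ≤ℚ_) (βgap-even even) (μ≤βgap i 1≤i i<k))))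
    (λ _ even → ⊥-elim (odd⇒¬even {k} k-odd even))
    i<k+1 1≤i

mainTheorem3 : (G : Graph) → IsSimple G → Connected G →
    (k : ℕ) → 1 ≤ k → Odd k →
    (α : ℕ → ℚ) →
    0ℚ <ℚ α 1 →
    (∀ i → 1 ≤ i → i < k → α i <ℚ α (suc i)) →
    α k <ℚ 1ℚ →
    0ℚ <ℚ N G (α 1) →
    (∀ i → 1 ≤ i → i < k → Odd i → N G (α (suc i)) <ℚ N G (α i)) →
    (∀ i → 1 ≤ i → i < k → Even i → N G (α i) <ℚ N G (α (suc i))) →
    Σ ℕ (λ l → 1 ≤ l × Σ (ℕ → ℚ) (λ α′ →
      0ℚ <ℚ α′ 1 ×
      (∀ i → 1 ≤ i → i < suc k → α′ i <ℚ α′ (suc i)) ×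
      α′ (suc k) <ℚ 1ℚ ×
      0ℚ <ℚ N (addIsolated (lexK G l)) (α′ 1) ×
      (∀ i → 1 ≤ i → i < suc k → Odd i →
        N (addIsolated (lexK G l)) (α′ (suc i)) <ℚ N (addIsolated (lexK G l)) (α′ i)) ×
      (∀ i → 1 ≤ i → i < suc k → Even i →
        N (addIsolated (lexK G l)) (α′ i) <ℚ N (addIsolated (lexK G l)) (α′ (suc i)))))
mainTheorem3 G _ connected k 1≤k k-odd α 0<α₁ α-increasing αₖ<1 0<β₁ β-odd β-even =
  l , s≤s z≤n , α′ , α′₁-pos , α′-increasing , α′-last<1 , N-first-pos , N-odd , N-even
  where
  open Construction G connected k 1≤k k-odd α 0<α₁ α-increasing αₖ<1 0<β₁ β-odd β-even
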